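{- Let $t$ be a complex number such that $(2m-1)t\neq \pm 2k$ for all positive integers $m,k$, and let $s$ be a positive integer. Then \[ D_s=\det \Bigl(\frac1{(2l)^2-t^2(2i-1)^2}\Bigr)_{1\le i, l\le s}=\prod_{j=1}^s U_{j,j}, \] where \[ U_{j,j}=\frac{t^{2j-2}(-1)^j16^{j-1}(2j-2)!}{\prod_{k=1}^j\bigl((2k-1)^2t^2-(2j)^2 \bigr)\, \prod_{k=1}^{j-1}\bigl((2j-1)^2t^2-(2k)^2 \bigr)}\, \frac{(2j-1)!}{j}. \]
   Context: Empty products equal $1$. -}

module Defs where

open import Level using (Level; _⊔_)
open import Data.Nat using (ℕ; zero; suc; _∸_) renaming (_+_ to _+ℕ_; _*_ to _*ℕ_)
open import Data.Nat.Base using (_!)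
open import Data.Fin using (Fin; zero; suc; toℕ; punchIn)
open import Algebra.Bundles using (CommutativeRing)
open import Relation.Nullary using (¬_)

-- A field of characteristic zero: a commutative ring with a total
-- inverse function (0⁻¹ = 0 convention, irrelevant below since all
-- inverted quantities are nonzero), nontrivial, every nonzero element
-- invertible, and n·1 ≠ 0 for all n ≥ 1.
-- embedding of ℕ into a commutative ring: ιR n = 1 + 1 + ... + 1 (n times)
ιR : {c ℓ : Level} (R : CommutativeRing c ℓ) → ℕ → CommutativeRing.Carrier R
ιR R zero = CommutativeRing.0# R
ιR R (suc n) = CommutativeRing._+_ R (CommutativeRing.1# R) (ιR R n)

record CharZeroField (c ℓ : Level) : Set (Level.suc (c ⊔ ℓ)) where
  field
    commRing : CommutativeRing c ℓ
  open CommutativeRing commRing public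
  field
    _⁻¹ : Carrier → Carrier
    ⁻¹-inverse : ∀ x → ¬ (x ≈ 0#) → (x * (x ⁻¹)) ≈ 1#
    ⁻¹-zero : (0# ⁻¹) ≈ 0#
    1≉0 : ¬ (1# ≈ 0#)
    charZero : ∀ n → ¬ (ιR commRing (suc n) ≈ 0#)
  ι : ℕ → Carrier
  ι = ιR commRing

module _ {c ℓ : Level} (F : CharZeroField c ℓ) where
  open CharZeroField F hiding (zero)

  pow : Carrier → ℕ → Carrier
  pow x zero = 1#
  pow x (suc n) = x * pow x n

  sgn : ℕ → Carrier
  sgn zero = 1#
  sgn (suc n) = - sgn n

  _÷_ : Carrier → Carrier → Carrier
  x ÷ y = x * (y ⁻¹)

  sumFin : (n : ℕ) → (Fin n → Carrier) → Carrier
  sumFin zero f = 0#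
  sumFin (suc n) f = f zero + sumFin n (λ i → f (suc i))

  prod1 : ℕ → (ℕ → Carrier) → Carrier
  prod1 zero f = 1#
  prod1 (suc n) f = prod1 n f * f (suc n)

  det : (n : ℕ) → (Fin n → Fin n → Carrier) → Carrier
  det zero M = 1#
  det (suc n) M =
    sumFin (suc n) (λ j → (sgn (toℕ j) * M zero j)
                           * det n (λ i l → M (suc i) (punchIn j l)))

  entry : Carrier → ℕ → ℕ → Carrier
  entry t i l = 1# ÷ (pow (ι (2 *ℕ l)) 2 - pow t 2 * pow (ι (2 *ℕ i ∸ 1)) 2)

  D : Carrier → ℕ → Carrier
  D t s = det s (λ i l → entry t (suc (toℕ i)) (suc (toℕ l)))

  U : Carrier → ℕ → Carrier
  U t j =
    ((pow t (2 *ℕ j ∸ 2) * sgn j * pow (ι 16) (j ∸ 1) * ι ((2 *ℕ j ∸ 2) !))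
      ÷ (prod1 j (λ k → pow (ι (2 *ℕ k ∸ 1)) 2 * pow t 2 - pow (ι (2 *ℕ j)) 2)
         * prod1 (j ∸ 1) (λ k → pow (ι (2 *ℕ j ∸ 1)) 2 * pow t 2 - pow (ι (2 *ℕ k)) 2)))
    * (ι ((2 *ℕ j ∸ 1) !) ÷ ι j)

{-# OPTIONS --safe #-}
module Submission where

open import Defs
open import Level using (Level)
open import Data.Nat as ℕ using (ℕ; zero; suc; _∸_; _≤_; s≤s; z≤n; _!) renaming (_*_ to _*ℕ_; _+_ to _+ℕ_)
open import Data.Fin as Fin using (Fin; zero; suc; toℕ; punchIn; inject₁)
import Data.Fin.Properties as FinP
import Data.Nat.Properties as ℕP
open import Data.Empty using (⊥-elim)
open import Function using (_∘_)
open import Data.Product using (_×_; proj₁; proj₂)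
open import Relation.Nullary using (¬_; yes; no)
open import Data.Integer as ℤ using (ℤ; +_; -[1+_])
import Data.Integer.Properties as ℤP
open import Data.Sign as Sign using (Sign)
open import Data.Maybe using (Maybe; just; nothing)
open import Relation.Binary.PropositionalEquality as P using (_≡_)
open import Algebra.Solver.Ring.AlmostCommutativeRing using (fromCommutativeRing; _-Raw-AlmostCommutative⟶_)
import Algebra.Solver.Ring as RingSolver
import Algebra.Properties.Ring as RingProperties
import Algebra.Properties.CommutativeSemigroup as CommutativeSemigroupProperties

-- D_s is the Cauchy determinant det (1 / (x_l − y_i)) with nodes x_l = (2l)² and
-- y_i = t²(2i−1)², so D_s = ∏_{a<j} (x_j − x_a)(y_a − y_j) / ∏_{i,l} (x_l − y_i).
-- Cauchy's formula is proved by induction on the size: subtracting multiples of the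
-- first row clears the first column, and the remaining Schur complement is a Cauchy
-- matrix on the remaining nodes, up to scaling of rows and columns. Grouping the
-- factors of the quotient by their largest index j gives U_{j,j}, because
-- (x_j − x_a)(y_a − y_j) = −16t² (j−a)² (j+a)(j+a−1) and the product of
-- (j−a)² (j+a)(j+a−1) over 1 ≤ a < j is (2j−2)! (2j−1)! / j.

module FactorialProducts where
  open import Data.Nat
  open import Data.Nat.Properties
  open import Relation.Binary.PropositionalEquality
  open import Data.Nat.Tactic.RingSolver

  ∏ℕ : ℕ → (ℕ → ℕ) → ℕ
  ∏ℕ zero    f = 1
  ∏ℕ (suc n) f = ∏ℕ n f * f (suc n)

  ∏ℕ-peelˡ : ∀ n f → ∏ℕ (suc n) f ≡ f 1 * ∏ℕ n (λ a → f (suc a))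
  ∏ℕ-peelˡ zero    f = *-comm 1 (f 1)
  ∏ℕ-peelˡ (suc n) f = trans (cong (_* f (suc (suc n))) (∏ℕ-peelˡ n f)) (*-assoc (f 1) _ _)

  ∏ℕ-distrib-* : ∀ n f g → ∏ℕ n (λ a → f a * g a) ≡ ∏ℕ n f * ∏ℕ n g
  ∏ℕ-distrib-* zero    f g = refl
  ∏ℕ-distrib-* (suc n) f g rewrite ∏ℕ-distrib-* n f g =
    interchange (∏ℕ n f) (∏ℕ n g) (f (suc n)) (g (suc n))
    where
    interchange : ∀ a b c d → a * b * (c * d) ≡ a * c * (b * d)
    interchange = solve-∀

  ∏ℕ-reverse : ∀ n → ∏ℕ n (λ a → suc n ∸ a) ≡ n !
  ∏ℕ-reverse zero    = refl
  ∏ℕ-reverse (suc n) = trans (∏ℕ-peelˡ n (λ a → suc (suc n) ∸ a)) (cong (suc n *_) (∏ℕ-reverse n))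

  ∏ℕ-shift : ∀ c n → ∏ℕ n (λ a → c + a) * c ! ≡ (c + n) !
  ∏ℕ-shift c zero    = trans (+-identityʳ (c !)) (cong _! (sym (+-identityʳ c)))
  ∏ℕ-shift c (suc n) = begin
    ∏ℕ n (λ a → c + a) * (c + suc n) * c !    ≡⟨ rearrange (∏ℕ n (λ a → c + a)) (c + suc n) (c !) ⟩
    (c + suc n) * (∏ℕ n (λ a → c + a) * c !)  ≡⟨ cong ((c + suc n) *_) (∏ℕ-shift c n) ⟩
    (c + suc n) * (c + n) !                   ≡⟨ cong (λ z → z * (c + n) !) (+-suc c n) ⟩
    suc (c + n) * (c + n) !                   ≡⟨ cong _! (sym (+-suc c n)) ⟩
    (c + suc n) !                             ∎
    where
    open ≡-Reasoning
    rearrange : ∀ a b d → a * b * d ≡ b * (a * d)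
    rearrange = solve-∀

  factorials-as-∏ : ∀ n → (n + n) ! * (suc (n + n)) ! ≡
    suc n * ∏ℕ n (λ a → ((suc n ∸ a) * (suc n ∸ a)) * ((suc n + a) * (n + a)))
  factorials-as-∏ n = sym (begin
    suc n * ∏ℕ n (λ a → ((suc n ∸ a) * (suc n ∸ a)) * ((suc n + a) * (n + a)))
      ≡⟨ cong (suc n *_) (∏ℕ-distrib-* n _ _) ⟩
    suc n * (∏ℕ n (λ a → (suc n ∸ a) * (suc n ∸ a)) * ∏ℕ n (λ a → (suc n + a) * (n + a)))
      ≡⟨ cong₂ (λ u v → suc n * (u * v)) (∏ℕ-distrib-* n _ _) (∏ℕ-distrib-* n _ _) ⟩
    suc n * ((R * R) * (A * B))               ≡⟨ cong (λ r → suc n * ((r * r) * (A * B))) (∏ℕ-reverse n) ⟩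
    suc n * ((n ! * n !) * (A * B))           ≡⟨ rearrange (suc n) (n !) A B ⟩
    (A * (suc n * n !)) * (B * n !)           ≡⟨ cong₂ _*_ (∏ℕ-shift (suc n) n) (∏ℕ-shift n n) ⟩
    (suc n + n) ! * (n + n) !                 ≡⟨ *-comm ((suc n + n) !) _ ⟩
    (n + n) ! * (suc (n + n)) !               ∎)
    where
    open ≡-Reasoning
    R = ∏ℕ n (λ a → suc n ∸ a)
    A = ∏ℕ n (λ a → suc n + a)
    B = ∏ℕ n (λ a → n + a)
    rearrange : ∀ s f a b → s * ((f * f) * (a * b)) ≡ (a * (s * f)) * (b * f)
    rearrange = solve-∀

  2*[1+n]≡2+n+n : ∀ n → 2 * suc n ≡ suc (suc (n + n))
  2*[1+n]≡2+n+n = solve-∀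

  2*[1+n]∸2≡n+n : ∀ n → 2 * suc n ∸ 2 ≡ n + n
  2*[1+n]∸2≡n+n n = cong (_∸ 2) (2*[1+n]≡2+n+n n)

  2*[1+n]∸1≡1+n+n : ∀ n → 2 * suc n ∸ 1 ≡ suc (n + n)
  2*[1+n]∸1≡1+n+n n = cong (_∸ 1) (2*[1+n]≡2+n+n n)

open FactorialProducts using (∏ℕ; factorials-as-∏; 2*[1+n]∸2≡n+n; 2*[1+n]∸1≡1+n+n)

module CharZero {c ℓ : Level} (F : CharZeroField c ℓ) where
  open CharZeroField F hiding (zero)
  open import Relation.Binary.Reasoning.Setoid setoid
  open RingProperties ring
    using (-‿distribˡ-*; -‿distribʳ-*; -1*x≈-x; -‿involutive; -0#≈0#; -‿+-comm; +-inverseʳ-unique; x∙y⁻¹≈ε⇒x≈y)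
  open CommutativeSemigroupProperties *-commutativeSemigroup using (interchange; x∙yz≈y∙xz)
  open CommutativeSemigroupProperties +-commutativeSemigroup using () renaming (interchange to +-interchange)

  -- Ring solver with integer coefficients

  ι-homo-+ : ∀ m n → ι (m +ℕ n) ≈ ι m + ι n
  ι-homo-+ zero    n = sym (+-identityˡ _)
  ι-homo-+ (suc m) n = trans (+-congˡ (ι-homo-+ m n)) (sym (+-assoc _ _ _))

  ι-homo-* : ∀ m n → ι (m *ℕ n) ≈ ι m * ι n
  ι-homo-* zero    n = sym (zeroˡ _)
  ι-homo-* (suc m) n = begin
    ι (n +ℕ m *ℕ n)       ≈⟨ ι-homo-+ n (m *ℕ n) ⟩
    ι n + ι (m *ℕ n)      ≈⟨ +-cong (sym (*-identityˡ _)) (ι-homo-* m n) ⟩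
    1# * ι n + ι m * ι n  ≈⟨ sym (distribʳ _ _ _) ⟩
    (1# + ι m) * ι n      ∎

  ιSign : Sign → Carrier
  ιSign Sign.+ = 1#
  ιSign Sign.- = - 1#

  ιSign-homo-* : ∀ s s′ → ιSign (s Sign.* s′) ≈ ιSign s * ιSign s′
  ιSign-homo-* Sign.+ Sign.+ = sym (*-identityˡ _)
  ιSign-homo-* Sign.+ Sign.- = sym (*-identityˡ _)
  ιSign-homo-* Sign.- Sign.+ = sym (*-identityʳ _)
  ιSign-homo-* Sign.- Sign.- = sym (trans (-1*x≈-x _) (-‿involutive 1#))

  ιℤ : ℤ → Carrier
  ιℤ (+ n)    = ι n
  ιℤ -[1+ n ] = - ι (suc n)

  ιℤ-⊖ : ∀ m n → ιℤ (m ℤ.⊖ n) ≈ ι m - ι n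
  ιℤ-⊖ zero    zero    = sym (-‿inverseʳ 0#)
  ιℤ-⊖ (suc m) zero    = sym (trans (+-congˡ -0#≈0#) (+-identityʳ _))
  ιℤ-⊖ zero    (suc n) = sym (+-identityˡ _)
  ιℤ-⊖ (suc m) (suc n) = begin
    ιℤ (suc m ℤ.⊖ suc n)       ≡⟨ P.cong ιℤ (ℤP.[1+m]⊖[1+n]≡m⊖n m n) ⟩
    ιℤ (m ℤ.⊖ n)               ≈⟨ ιℤ-⊖ m n ⟩
    ι m - ι n                  ≈⟨ sym (+-identityˡ _) ⟩
    0# + (ι m - ι n)           ≈⟨ +-congʳ (sym (-‿inverseʳ 1#)) ⟩
    (1# - 1#) + (ι m - ι n)    ≈⟨ +-interchange _ _ _ _ ⟩
    (1# + ι m) + (- 1# - ι n)  ≈⟨ +-congˡ (-‿+-comm 1# (ι n)) ⟩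
    ι (suc m) - ι (suc n)      ∎

  ιℤ-homo-+ : ∀ i j → ιℤ (i ℤ.+ j) ≈ ιℤ i + ιℤ j
  ιℤ-homo-+ -[1+ m ] -[1+ n ] = begin
    - (1# + ι (suc m +ℕ n))     ≈⟨ -‿cong (+-congˡ (ι-homo-+ (suc m) n)) ⟩
    - (1# + (ι (suc m) + ι n))  ≈⟨ -‿cong (trans (sym (+-assoc _ _ _)) (trans (+-congʳ (+-comm _ _)) (+-assoc _ _ _))) ⟩
    - (ι (suc m) + (1# + ι n))  ≈⟨ sym (-‿+-comm _ _) ⟩
    - ι (suc m) + - ι (suc n)   ∎
  ιℤ-homo-+ -[1+ m ] (+ n)    = trans (ιℤ-⊖ n (suc m)) (+-comm _ _)
  ιℤ-homo-+ (+ m)    -[1+ n ] = ιℤ-⊖ m (suc n)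
  ιℤ-homo-+ (+ m)    (+ n)    = ι-homo-+ m n

  ιℤ-◃ : ∀ s n → ιℤ (s ℤ.◃ n) ≈ ιSign s * ι n
  ιℤ-◃ s      zero    = sym (zeroʳ _)
  ιℤ-◃ Sign.+ (suc n) = sym (*-identityˡ _)
  ιℤ-◃ Sign.- (suc n) = sym (-1*x≈-x _)

  ιℤ≈sign*abs : ∀ i → ιℤ i ≈ ιSign (ℤ.sign i) * ι ℤ.∣ i ∣
  ιℤ≈sign*abs (+ n)    = sym (*-identityˡ _)
  ιℤ≈sign*abs -[1+ n ] = sym (-1*x≈-x _)

  ιℤ-homo-* : ∀ i j → ιℤ (i ℤ.* j) ≈ ιℤ i * ιℤ j
  ιℤ-homo-* i j = begin
    ιℤ (i ℤ.* j)
      ≈⟨ ιℤ-◃ (ℤ.sign i Sign.* ℤ.sign j) (ℤ.∣ i ∣ ℕ.* ℤ.∣ j ∣) ⟩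
    ιSign (ℤ.sign i Sign.* ℤ.sign j) * ι (ℤ.∣ i ∣ ℕ.* ℤ.∣ j ∣)
      ≈⟨ *-cong (ιSign-homo-* (ℤ.sign i) (ℤ.sign j)) (ι-homo-* ℤ.∣ i ∣ ℤ.∣ j ∣) ⟩
    (ιSign (ℤ.sign i) * ιSign (ℤ.sign j)) * (ι ℤ.∣ i ∣ * ι ℤ.∣ j ∣)
      ≈⟨ interchange _ _ _ _ ⟩
    (ιSign (ℤ.sign i) * ι ℤ.∣ i ∣) * (ιSign (ℤ.sign j) * ι ℤ.∣ j ∣)
      ≈⟨ sym (*-cong (ιℤ≈sign*abs i) (ιℤ≈sign*abs j)) ⟩
    ιℤ i * ιℤ j ∎

  ιℤ-homo-neg : ∀ i → ιℤ (ℤ.- i) ≈ - ιℤ i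
  ιℤ-homo-neg (+ zero)  = sym -0#≈0#
  ιℤ-homo-neg (+ suc n) = refl
  ιℤ-homo-neg -[1+ n ]  = sym (-‿involutive _)

  -- Agrees with ιℤ, but sends 1 and -1 to 1# and - 1# on the nose, so that the
  -- solver constants con (+ 1) and con -[1+ 0 ] denote 1# and - 1# definitionally.
  coefficient : ℤ → Carrier
  coefficient (+ zero)          = 0#
  coefficient (+ suc zero)      = 1#
  coefficient (+ suc (suc n))   = ι (suc (suc n))
  coefficient -[1+ zero ]       = - 1#
  coefficient -[1+ suc n ]      = - ι (suc (suc n))

  coefficient≈ιℤ : ∀ i → coefficient i ≈ ιℤ i
  coefficient≈ιℤ (+ zero)        = refl
  coefficient≈ιℤ (+ suc zero)    = sym (+-identityʳ _)
  coefficient≈ιℤ (+ suc (suc n)) = refl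
  coefficient≈ιℤ -[1+ zero ]     = -‿cong (sym (+-identityʳ _))
  coefficient≈ιℤ -[1+ suc n ]    = refl

  coefficient-homomorphism : ℤ.+-*-rawRing -Raw-AlmostCommutative⟶ fromCommutativeRing commRing
  coefficient-homomorphism = record
    { ⟦_⟧    = coefficient
    ; +-homo = λ i j → transport (ℤ._+_ i j) (ιℤ-homo-+ i j) (+-cong (coefficient≈ιℤ i) (coefficient≈ιℤ j))
    ; *-homo = λ i j → transport (ℤ._*_ i j) (ιℤ-homo-* i j) (*-cong (coefficient≈ιℤ i) (coefficient≈ιℤ j))
    ; -‿homo = λ i → transport (ℤ.- i) (ιℤ-homo-neg i) (-‿cong (coefficient≈ιℤ i))
    ; 0-homo = refl
    ; 1-homo = refl
    }
    where
    transport : ∀ k {a b} → ιℤ k ≈ a → b ≈ a → coefficient k ≈ b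
    transport k eq eq′ = trans (coefficient≈ιℤ k) (trans eq (sym eq′))

  coefficient-equal? : ∀ i j → Maybe (coefficient i ≈ coefficient j)
  coefficient-equal? i j with i ℤP.≟ j
  ... | yes P.refl = just refl
  ... | no _       = nothing

  open RingSolver ℤ.+-*-rawRing (fromCommutativeRing commRing) coefficient-homomorphism coefficient-equal?

  ι-homo-∸ : ∀ m n → n ≤ m → ι (m ∸ n) ≈ ι m - ι n
  ι-homo-∸ m n n≤m = begin
    ι (m ∸ n)                ≈⟨ solve 2 (λ a b → a := (a :+ b) :- b) refl _ _ ⟩
    (ι (m ∸ n) + ι n) - ι n  ≈⟨ +-congʳ (sym (ι-homo-+ (m ∸ n) n)) ⟩
    ι (m ∸ n +ℕ n) - ι n     ≡⟨ P.cong (λ z → ι z - ι n) (ℕP.m∸n+n≡m n≤m) ⟩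
    ι m - ι n                ∎

  Nonzero : Carrier → Set ℓ
  Nonzero x = ¬ (x ≈ 0#)

  ⁻¹-inverseˡ : ∀ x → Nonzero x → x ⁻¹ * x ≈ 1#
  ⁻¹-inverseˡ x x≉0 = trans (*-comm _ _) (⁻¹-inverse x x≉0)

  *-cancelˡ : ∀ a {x y} → Nonzero a → a * x ≈ a * y → x ≈ y
  *-cancelˡ a {x} {y} a≉0 ax≈ay = begin
    x                 ≈⟨ sym (*-identityˡ x) ⟩
    1# * x            ≈⟨ *-congʳ (sym (⁻¹-inverseˡ a a≉0)) ⟩
    (a ⁻¹ * a) * x    ≈⟨ *-assoc _ _ _ ⟩
    a ⁻¹ * (a * x)    ≈⟨ *-congˡ ax≈ay ⟩
    a ⁻¹ * (a * y)    ≈⟨ sym (*-assoc _ _ _) ⟩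
    (a ⁻¹ * a) * y    ≈⟨ *-congʳ (⁻¹-inverseˡ a a≉0) ⟩
    1# * y            ≈⟨ *-identityˡ y ⟩
    y                 ∎

  *-cancelʳ : ∀ a {x y} → Nonzero a → x * a ≈ y * a → x ≈ y
  *-cancelʳ a a≉0 xa≈ya = *-cancelˡ a a≉0 (trans (*-comm _ _) (trans xa≈ya (*-comm _ _)))

  *-nonzero : ∀ {a b} → Nonzero a → Nonzero b → Nonzero (a * b)
  *-nonzero {a} {b} a≉0 b≉0 ab≈0 = b≉0 (*-cancelˡ a a≉0 (trans ab≈0 (sym (zeroʳ a))))

  x≈-x⇒x≈0 : ∀ x → x ≈ - x → x ≈ 0#
  x≈-x⇒x≈0 x x≈-x = *-cancelˡ (ι 2) (charZero 1) (begin
    ι 2 * x   ≈⟨ solve 1 (λ x → con (+ 2) :* x := x :+ x) refl x ⟩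
    x + x     ≈⟨ +-congˡ x≈-x ⟩
    x - x     ≈⟨ -‿inverseʳ x ⟩
    0#        ≈⟨ sym (zeroʳ _) ⟩
    ι 2 * 0#  ∎)

  -- Opaque copies of the definitions: their function arguments can then be
  -- inferred by unification, which fails once sumFin (suc n) f starts to compute.
  opaque
    Σ : (n : ℕ) → (Fin n → Carrier) → Carrier
    Σ = sumFin F

    Π : (n : ℕ) → (Fin n → Carrier) → Carrier
    Π zero    f = 1#
    Π (suc n) f = f zero * Π n (λ i → f (suc i))

    ∏ : ℕ → (ℕ → Carrier) → Carrier
    ∏ = prod1 F

    sign : ℕ → Carrier
    sign = sgn F

    Det : (n : ℕ) → (Fin n → Fin n → Carrier) → Carrier
    Det = det F

    Σ-zero : ∀ f → Σ 0 f ≡ 0#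
    Σ-zero f = P.refl

    Σ-suc : ∀ n f → Σ (suc n) f ≡ f zero + Σ n (λ i → f (suc i))
    Σ-suc n f = P.refl

    Π-zero : ∀ f → Π 0 f ≡ 1#
    Π-zero f = P.refl

    Π-suc : ∀ n f → Π (suc n) f ≡ f zero * Π n (λ i → f (suc i))
    Π-suc n f = P.refl

    ∏-zero : ∀ f → ∏ 0 f ≡ 1#
    ∏-zero f = P.refl

    ∏-suc : ∀ n f → ∏ (suc n) f ≡ ∏ n f * f (suc n)
    ∏-suc n f = P.refl

    ∏≡prod1 : ∀ n f → ∏ n f ≡ prod1 F n f
    ∏≡prod1 n f = P.refl

    sign-zero : sign 0 ≡ 1#
    sign-zero = P.refl

    sign-suc : ∀ k → sign (suc k) ≡ - sign k
    sign-suc k = P.refl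

    sign≡sgn : ∀ k → sign k ≡ sgn F k
    sign≡sgn k = P.refl

    Det-zero : ∀ M → Det 0 M ≡ 1#
    Det-zero M = P.refl

    Det-suc : ∀ n M → Det (suc n) M ≡
      Σ (suc n) (λ j → (sign (toℕ j) * M zero j) * Det n (λ i l → M (suc i) (punchIn j l)))
    Det-suc n M = P.refl

    Det≡det : ∀ n M → Det n M ≡ det F n M
    Det≡det n M = P.refl

  Σ-cong : ∀ n {f g : Fin n → Carrier} → (∀ i → f i ≈ g i) → Σ n f ≈ Σ n g
  Σ-cong zero    {f} {g} f≈g = reflexive (P.trans (Σ-zero f) (P.sym (Σ-zero g)))
  Σ-cong (suc n) {f} {g} f≈g = begin
    Σ (suc n) f                      ≡⟨ Σ-suc n f ⟩
    f zero + Σ n (λ i → f (suc i))   ≈⟨ +-cong (f≈g zero) (Σ-cong n (λ i → f≈g (suc i))) ⟩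
    g zero + Σ n (λ i → g (suc i))   ≡⟨ P.sym (Σ-suc n g) ⟩
    Σ (suc n) g                      ∎

  Σ-vanishing : ∀ n (f : Fin n → Carrier) → (∀ i → f i ≈ 0#) → Σ n f ≈ 0#
  Σ-vanishing zero    f f≈0 = reflexive (Σ-zero f)
  Σ-vanishing (suc n) f f≈0 = begin
    Σ (suc n) f                      ≡⟨ Σ-suc n f ⟩
    f zero + Σ n (λ i → f (suc i))   ≈⟨ +-cong (f≈0 zero) (Σ-vanishing n _ (λ i → f≈0 (suc i))) ⟩
    0# + 0#                          ≈⟨ +-identityˡ _ ⟩
    0#                               ∎

  Σ-distrib-+ : ∀ n (f g : Fin n → Carrier) → Σ n (λ i → f i + g i) ≈ Σ n f + Σ n g
  Σ-distrib-+ zero    f g = begin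
    Σ 0 _           ≡⟨ Σ-zero _ ⟩
    0#              ≈⟨ sym (+-identityˡ _) ⟩
    0# + 0#         ≡⟨ P.sym (P.cong₂ _+_ (Σ-zero f) (Σ-zero g)) ⟩
    Σ 0 f + Σ 0 g   ∎
  Σ-distrib-+ (suc n) f g = begin
    Σ (suc n) (λ i → f i + g i)
      ≡⟨ Σ-suc n _ ⟩
    (f zero + g zero) + Σ n (λ i → f (suc i) + g (suc i))
      ≈⟨ +-congˡ (Σ-distrib-+ n _ _) ⟩
    (f zero + g zero) + (Σ n (λ i → f (suc i)) + Σ n (λ i → g (suc i)))
      ≈⟨ +-interchange _ _ _ _ ⟩
    (f zero + Σ n (λ i → f (suc i))) + (g zero + Σ n (λ i → g (suc i)))
      ≡⟨ P.sym (P.cong₂ _+_ (Σ-suc n f) (Σ-suc n g)) ⟩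
    Σ (suc n) f + Σ (suc n) g ∎

  *-distribˡ-Σ : ∀ n k (f : Fin n → Carrier) → k * Σ n f ≈ Σ n (λ i → k * f i)
  *-distribˡ-Σ zero    k f = begin
    k * Σ 0 f   ≡⟨ P.cong (k *_) (Σ-zero f) ⟩
    k * 0#      ≈⟨ zeroʳ _ ⟩
    0#          ≡⟨ P.sym (Σ-zero _) ⟩
    Σ 0 _       ∎
  *-distribˡ-Σ (suc n) k f = begin
    k * Σ (suc n) f                           ≡⟨ P.cong (k *_) (Σ-suc n f) ⟩
    k * (f zero + Σ n (λ i → f (suc i)))      ≈⟨ distribˡ _ _ _ ⟩
    k * f zero + k * Σ n (λ i → f (suc i))    ≈⟨ +-congˡ (*-distribˡ-Σ n k _) ⟩
    k * f zero + Σ n (λ i → k * f (suc i))    ≡⟨ P.sym (Σ-suc n _) ⟩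
    Σ (suc n) (λ i → k * f i)                 ∎

  -‿distrib-Σ : ∀ n (f : Fin n → Carrier) → - Σ n f ≈ Σ n (λ i → - f i)
  -‿distrib-Σ n f = trans (sym (-1*x≈-x _)) (trans (*-distribˡ-Σ n (- 1#) f) (Σ-cong n (λ i → -1*x≈-x _)))

  Π-punchIn : ∀ n (f : Fin (suc n) → Carrier) j → Π (suc n) f ≈ f j * Π n (λ l → f (punchIn j l))
  Π-punchIn n       f zero    = reflexive (Π-suc n f)
  Π-punchIn (suc n) f (suc j) = begin
    Π (suc (suc n)) f                                         ≡⟨ Π-suc (suc n) f ⟩
    f zero * Π (suc n) (λ i → f (suc i))                      ≈⟨ *-congˡ (Π-punchIn n (λ i → f (suc i)) j) ⟩
    f zero * (f (suc j) * Π n (λ l → f (suc (punchIn j l))))  ≈⟨ x∙yz≈y∙xz _ _ _ ⟩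
    f (suc j) * (f zero * Π n (λ l → f (suc (punchIn j l))))  ≡⟨ P.cong (f (suc j) *_) (P.sym (Π-suc n _)) ⟩
    f (suc j) * Π (suc n) (λ l → f (punchIn (suc j) l))       ∎

  Π≈∏ : ∀ n (g : ℕ → Carrier) → Π n (λ i → g (suc (toℕ i))) ≈ ∏ n g
  ∏-peelˡ : ∀ n (g : ℕ → Carrier) → ∏ (suc n) g ≈ g 1 * ∏ n (λ k → g (suc k))

  Π≈∏ zero    g = reflexive (P.trans (Π-zero _) (P.sym (∏-zero g)))
  Π≈∏ (suc n) g = begin
    Π (suc n) (λ i → g (suc (toℕ i)))         ≡⟨ Π-suc n _ ⟩
    g 1 * Π n (λ i → g (suc (suc (toℕ i))))   ≈⟨ *-congˡ (Π≈∏ n (λ k → g (suc k))) ⟩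
    g 1 * ∏ n (λ k → g (suc k))               ≈⟨ sym (∏-peelˡ n g) ⟩
    ∏ (suc n) g                               ∎

  ∏-peelˡ zero    g = begin
    ∏ 1 g          ≡⟨ P.trans (∏-suc 0 g) (P.cong (_* g 1) (∏-zero g)) ⟩
    1# * g 1       ≈⟨ *-comm _ _ ⟩
    g 1 * 1#       ≡⟨ P.cong (g 1 *_) (P.sym (∏-zero _)) ⟩
    g 1 * ∏ 0 _    ∎
  ∏-peelˡ (suc n) g = begin
    ∏ (suc (suc n)) g                                 ≡⟨ ∏-suc (suc n) g ⟩
    ∏ (suc n) g * g (suc (suc n))                     ≈⟨ *-congʳ (∏-peelˡ n g) ⟩
    (g 1 * ∏ n (λ k → g (suc k))) * g (suc (suc n))   ≈⟨ *-assoc _ _ _ ⟩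
    g 1 * (∏ n (λ k → g (suc k)) * g (suc (suc n)))   ≡⟨ P.cong (g 1 *_) (P.sym (∏-suc n _)) ⟩
    g 1 * ∏ (suc n) (λ k → g (suc k))                 ∎

  ∏-cong : ∀ n {f g : ℕ → Carrier} → (∀ i → i ℕ.< n → f (suc i) ≈ g (suc i)) → ∏ n f ≈ ∏ n g
  ∏-cong zero    {f} {g} f≈g = reflexive (P.trans (∏-zero f) (P.sym (∏-zero g)))
  ∏-cong (suc n) {f} {g} f≈g = begin
    ∏ (suc n) f          ≡⟨ ∏-suc n f ⟩
    ∏ n f * f (suc n)    ≈⟨ *-cong (∏-cong n (λ i i<n → f≈g i (ℕP.m<n⇒m<1+n i<n))) (f≈g n ℕP.≤-refl) ⟩
    ∏ n g * g (suc n)    ≡⟨ P.sym (∏-suc n g) ⟩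
    ∏ (suc n) g          ∎

  ∏-distrib-* : ∀ n (f g : ℕ → Carrier) → ∏ n (λ i → f i * g i) ≈ ∏ n f * ∏ n g
  ∏-distrib-* zero    f g = begin
    ∏ 0 _           ≡⟨ ∏-zero _ ⟩
    1#              ≈⟨ sym (*-identityˡ _) ⟩
    1# * 1#         ≡⟨ P.sym (P.cong₂ _*_ (∏-zero f) (∏-zero g)) ⟩
    ∏ 0 f * ∏ 0 g   ∎
  ∏-distrib-* (suc n) f g = begin
    ∏ (suc n) (λ i → f i * g i)                     ≡⟨ ∏-suc n _ ⟩
    ∏ n (λ i → f i * g i) * (f (suc n) * g (suc n)) ≈⟨ *-congʳ (∏-distrib-* n f g) ⟩
    (∏ n f * ∏ n g) * (f (suc n) * g (suc n))       ≈⟨ interchange _ _ _ _ ⟩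
    (∏ n f * f (suc n)) * (∏ n g * g (suc n))       ≡⟨ P.sym (P.cong₂ _*_ (∏-suc n f) (∏-suc n g)) ⟩
    ∏ (suc n) f * ∏ (suc n) g                       ∎

  ∏-const : ∀ n c → ∏ n (λ _ → c) ≈ pow F c n
  ∏-const zero    c = reflexive (∏-zero _)
  ∏-const (suc n) c = trans (reflexive (∏-suc n _)) (trans (*-congʳ (∏-const n c)) (*-comm _ _))

  ∏-inverse : ∀ n (f : ℕ → Carrier) → (∀ k → Nonzero (f (suc k))) → ∏ n (λ k → f k ⁻¹) * ∏ n f ≈ 1#
  ∏-inverse n f f≉0 = begin
    ∏ n (λ k → f k ⁻¹) * ∏ n f   ≈⟨ sym (∏-distrib-* n _ _) ⟩
    ∏ n (λ k → f k ⁻¹ * f k)     ≈⟨ ∏-cong n (λ k _ → ⁻¹-inverseˡ _ (f≉0 k)) ⟩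
    ∏ n (λ _ → 1#)               ≈⟨ ∏-const n 1# ⟩
    pow F 1# n                   ≈⟨ pow-one n ⟩
    1#                           ∎
    where
    pow-one : ∀ n → pow F 1# n ≈ 1#
    pow-one zero    = refl
    pow-one (suc n) = trans (*-identityˡ _) (pow-one n)

  ∏-nonzero : ∀ n (f : ℕ → Carrier) → (∀ k → Nonzero (f (suc k))) → Nonzero (∏ n f)
  ∏-nonzero zero    f f≉0 ∏≈0 = 1≉0 (trans (reflexive (P.sym (∏-zero f))) ∏≈0)
  ∏-nonzero (suc n) f f≉0 ∏≈0 =
    *-nonzero (∏-nonzero n f f≉0) (f≉0 n) (trans (reflexive (P.sym (∏-suc n f))) ∏≈0)

  sign-square : ∀ n → sign n * sign n ≈ 1#
  sign-square zero    = trans (reflexive (P.cong₂ _*_ sign-zero sign-zero)) (*-identityˡ _)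
  sign-square (suc n) = begin
    sign (suc n) * sign (suc n)   ≡⟨ P.cong₂ _*_ (sign-suc n) (sign-suc n) ⟩
    - sign n * - sign n           ≈⟨ solve 1 (λ s → (:- s) :* (:- s) := s :* s) refl _ ⟩
    sign n * sign n               ≈⟨ sign-square n ⟩
    1#                            ∎

  ∏-neg : ∀ n f → ∏ n (λ k → - f k) ≈ sign n * ∏ n f
  ∏-neg zero    f = trans (reflexive (∏-zero _)) (sym (trans (*-cong (reflexive sign-zero) (reflexive (∏-zero f))) (*-identityˡ _)))
  ∏-neg (suc n) f = begin
    ∏ (suc n) (λ k → - f k)           ≡⟨ ∏-suc n _ ⟩
    ∏ n (λ k → - f k) * - f (suc n)   ≈⟨ *-congʳ (∏-neg n f) ⟩
    (sign n * ∏ n f) * - f (suc n)    ≈⟨ solve 3 (λ s p a → (s :* p) :* (:- a) := (:- s) :* (p :* a)) refl _ _ _ ⟩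
    (- sign n) * (∏ n f * f (suc n))  ≡⟨ P.sym (P.cong₂ _*_ (sign-suc n) (∏-suc n f)) ⟩
    sign (suc n) * ∏ (suc n) f        ∎

  pow-distrib-* : ∀ n a b → pow F (a * b) n ≈ pow F a n * pow F b n
  pow-distrib-* zero    a b = sym (*-identityˡ _)
  pow-distrib-* (suc n) a b = trans (*-congˡ (pow-distrib-* n a b)) (interchange _ _ _ _)

  pow-neg : ∀ n c → pow F (- c) n ≈ sign n * pow F c n
  pow-neg zero    c = sym (trans (*-congʳ (reflexive sign-zero)) (*-identityˡ _))
  pow-neg (suc n) c = begin
    - c * pow F (- c) n         ≈⟨ *-congˡ (pow-neg n c) ⟩
    - c * (sign n * pow F c n)  ≈⟨ solve 3 (λ c s p → (:- c) :* (s :* p) := (:- s) :* (c :* p)) refl _ _ _ ⟩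
    - sign n * (c * pow F c n)  ≡⟨ P.cong (_* (c * pow F c n)) (P.sym (sign-suc n)) ⟩
    sign (suc n) * pow F c (suc n) ∎

  ι-∏ℕ : ∀ n f → ι (∏ℕ n f) ≈ ∏ n (λ a → ι (f a))
  ι-∏ℕ zero    f = trans (+-identityʳ _) (reflexive (P.sym (∏-zero _)))
  ι-∏ℕ (suc n) f = begin
    ι (∏ℕ n f *ℕ f (suc n))             ≈⟨ ι-homo-* (∏ℕ n f) (f (suc n)) ⟩
    ι (∏ℕ n f) * ι (f (suc n))          ≈⟨ *-congʳ (ι-∏ℕ n f) ⟩
    ∏ n (λ a → ι (f a)) * ι (f (suc n)) ≡⟨ P.sym (∏-suc n _) ⟩
    ∏ (suc n) (λ a → ι (f a))           ∎

  -- Determinants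

  Mat : ℕ → Set c
  Mat n = Fin n → Fin n → Carrier

  minor : ∀ {n} → Mat (suc n) → Fin (suc n) → Mat n
  minor M j i l = M (suc i) (punchIn j l)

  laplaceTerm : ∀ {n} → Mat (suc n) → Fin (suc n) → Carrier
  laplaceTerm {n} M j = (sign (toℕ j) * M zero j) * Det n (minor M j)

  det-cong : ∀ n {M N : Mat n} → (∀ i l → M i l ≈ N i l) → Det n M ≈ Det n N
  det-cong zero    {M} {N} M≈N = reflexive (P.trans (Det-zero M) (P.sym (Det-zero N)))
  det-cong (suc n) {M} {N} M≈N = begin
    Det (suc n) M                  ≡⟨ Det-suc n M ⟩
    Σ (suc n) (laplaceTerm M)      ≈⟨ Σ-cong (suc n) (λ j →
                                       *-cong (*-congˡ (M≈N zero j)) (det-cong n (λ i l → M≈N (suc i) (punchIn j l)))) ⟩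
    Σ (suc n) (laplaceTerm N)      ≡⟨ P.sym (Det-suc n N) ⟩
    Det (suc n) N                  ∎

  det-scaleRows : ∀ n (a : Fin n → Carrier) (M : Mat n) → Det n (λ i l → a i * M i l) ≈ Π n a * Det n M
  det-scaleRows zero    a M = begin
    Det 0 _             ≡⟨ Det-zero _ ⟩
    1#                  ≈⟨ sym (*-identityˡ _) ⟩
    1# * 1#             ≡⟨ P.sym (P.cong₂ _*_ (Π-zero a) (Det-zero M)) ⟩
    Π 0 a * Det 0 M     ∎
  det-scaleRows (suc n) a M = begin
    Det (suc n) aM                                            ≡⟨ Det-suc n aM ⟩
    Σ (suc n) (laplaceTerm aM)                                ≈⟨ Σ-cong (suc n) scaledTerm ⟩
    Σ (suc n) (λ j → (a zero * Π n (λ i → a (suc i))) * laplaceTerm M j)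
                                                              ≈⟨ sym (*-distribˡ-Σ (suc n) _ (laplaceTerm M)) ⟩
    (a zero * Π n (λ i → a (suc i))) * Σ (suc n) (laplaceTerm M)
                                                              ≡⟨ P.sym (P.cong₂ _*_ (Π-suc n a) (Det-suc n M)) ⟩
    Π (suc n) a * Det (suc n) M                               ∎
    where
    aM : Mat (suc n)
    aM i l = a i * M i l
    scaledTerm : ∀ j → laplaceTerm aM j ≈ (a zero * Π n (λ i → a (suc i))) * laplaceTerm M j
    scaledTerm j = trans (*-congˡ (det-scaleRows n (λ i → a (suc i)) (minor M j)))
      (solve 5 (λ s a₀ m p d → (s :* (a₀ :* m)) :* (p :* d) := (a₀ :* p) :* ((s :* m) :* d)) refl
        (sign (toℕ j)) (a zero) (M zero j) (Π n (λ i → a (suc i))) (Det n (minor M j)))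

  det-scaleColumns : ∀ n (b : Fin n → Carrier) (M : Mat n) → Det n (λ i l → b l * M i l) ≈ Π n b * Det n M
  det-scaleColumns zero    b M = begin
    Det 0 _             ≡⟨ Det-zero _ ⟩
    1#                  ≈⟨ sym (*-identityˡ _) ⟩
    1# * 1#             ≡⟨ P.sym (P.cong₂ _*_ (Π-zero b) (Det-zero M)) ⟩
    Π 0 b * Det 0 M     ∎
  det-scaleColumns (suc n) b M = begin
    Det (suc n) bM                                 ≡⟨ Det-suc n bM ⟩
    Σ (suc n) (laplaceTerm bM)                     ≈⟨ Σ-cong (suc n) scaledTerm ⟩
    Σ (suc n) (λ j → Π (suc n) b * laplaceTerm M j) ≈⟨ sym (*-distribˡ-Σ (suc n) _ (laplaceTerm M)) ⟩
    Π (suc n) b * Σ (suc n) (laplaceTerm M)        ≡⟨ P.cong (Π (suc n) b *_) (P.sym (Det-suc n M)) ⟩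
    Π (suc n) b * Det (suc n) M                    ∎
    where
    bM : Mat (suc n)
    bM i l = b l * M i l
    scaledTerm : ∀ j → laplaceTerm bM j ≈ Π (suc n) b * laplaceTerm M j
    scaledTerm j = trans (*-congˡ (det-scaleColumns n (λ l → b (punchIn j l)) (minor M j)))
      (trans (solve 5 (λ s b₀ m p d → (s :* (b₀ :* m)) :* (p :* d) := (b₀ :* p) :* ((s :* m) :* d)) refl
                (sign (toℕ j)) (b j) (M zero j) (Π n (λ l → b (punchIn j l))) (Det n (minor M j)))
             (*-congʳ (sym (Π-punchIn n b j))))

  det-linearInRow : ∀ n (r : Fin n) (A B C : Mat n) (k : Carrier) →
    (∀ i → ¬ (i ≡ r) → ∀ l → A i l ≈ C i l) →
    (∀ i → ¬ (i ≡ r) → ∀ l → B i l ≈ C i l) →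
    (∀ l → C r l ≈ A r l + k * B r l) →
    Det n C ≈ Det n A + k * Det n B
  det-linearInRow (suc n) r A B C k A≈C B≈C Cᵣ≈ = begin
    Det (suc n) C                               ≡⟨ Det-suc n C ⟩
    Σ (suc n) (laplaceTerm C)                   ≈⟨ Σ-cong (suc n) (linearTerm r A≈C B≈C Cᵣ≈) ⟩
    Σ (suc n) (λ j → laplaceTerm A j + k * laplaceTerm B j)
      ≈⟨ trans (Σ-distrib-+ (suc n) _ _) (+-congˡ (sym (*-distribˡ-Σ (suc n) k (laplaceTerm B)))) ⟩
    Σ (suc n) (laplaceTerm A) + k * Σ (suc n) (laplaceTerm B)
      ≡⟨ P.sym (P.cong₂ (λ a b → a + k * b) (Det-suc n A) (Det-suc n B)) ⟩
    Det (suc n) A + k * Det (suc n) B           ∎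
    where
    linearTerm : ∀ r → (∀ i → ¬ (i ≡ r) → ∀ l → A i l ≈ C i l) → (∀ i → ¬ (i ≡ r) → ∀ l → B i l ≈ C i l) →
      (∀ l → C r l ≈ A r l + k * B r l) → ∀ j → laplaceTerm C j ≈ laplaceTerm A j + k * laplaceTerm B j
    linearTerm zero A≈C B≈C Cᵣ≈ j = begin
      (sign (toℕ j) * C zero j) * Det n (minor C j)
        ≈⟨ *-congʳ (*-congˡ (Cᵣ≈ j)) ⟩
      (sign (toℕ j) * (A zero j + k * B zero j)) * Det n (minor C j)
        ≈⟨ solve 5 (λ s a k b d → (s :* (a :+ k :* b)) :* d := (s :* a) :* d :+ k :* ((s :* b) :* d)) refl
             (sign (toℕ j)) (A zero j) k (B zero j) (Det n (minor C j)) ⟩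
      (sign (toℕ j) * A zero j) * Det n (minor C j) + k * ((sign (toℕ j) * B zero j) * Det n (minor C j))
        ≈⟨ +-cong (*-congˡ (det-cong n (λ i l → sym (A≈C (suc i) (λ ()) (punchIn j l)))))
                  (*-congˡ (*-congˡ (det-cong n (λ i l → sym (B≈C (suc i) (λ ()) (punchIn j l)))))) ⟩
      laplaceTerm A j + k * laplaceTerm B j ∎
    linearTerm (suc r) A≈C B≈C Cᵣ≈ j = begin
      c₀ * Det n (minor C j)
        ≈⟨ *-congˡ (det-linearInRow n r (minor A j) (minor B j) (minor C j) k
             (λ i i≢r l → A≈C (suc i) (λ e → i≢r (FinP.suc-injective e)) (punchIn j l))
             (λ i i≢r l → B≈C (suc i) (λ e → i≢r (FinP.suc-injective e)) (punchIn j l))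
             (λ l → Cᵣ≈ (punchIn j l))) ⟩
      c₀ * (Det n (minor A j) + k * Det n (minor B j))
        ≈⟨ solve 4 (λ c k a b → c :* (a :+ k :* b) := c :* a :+ k :* (c :* b)) refl
             c₀ k (Det n (minor A j)) (Det n (minor B j)) ⟩
      c₀ * Det n (minor A j) + k * (c₀ * Det n (minor B j))
        ≈⟨ +-cong (*-congʳ (*-congˡ (sym (A≈C zero (λ ()) j)))) (*-congˡ (*-congʳ (*-congˡ (sym (B≈C zero (λ ()) j))))) ⟩
      laplaceTerm A j + k * laplaceTerm B j ∎
      where
      c₀ = sign (toℕ j) * C zero j

  ColumnFunctional : ℕ → Set c
  ColumnFunctional n = (Fin n → Fin (suc (suc n))) → Carrier

  Extensional : ∀ {n} → ColumnFunctional n → Set ℓ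
  Extensional {n} G = ∀ {σ τ : Fin n → Fin (suc (suc n))} → (∀ l → σ l ≡ τ l) → G σ ≈ G τ

  -- Laplace expansion along two rows A and B; G stands for the determinant of the
  -- remaining rows restricted to the columns left over.
  expand₂ : ∀ n (A B : Fin (suc (suc n)) → Carrier) → ColumnFunctional n → Carrier
  expand₂ n A B G = Σ (suc (suc n)) (λ j → (sign (toℕ j) * A j) *
    Σ (suc n) (λ k → (sign (toℕ k) * B (punchIn j k)) * G (λ l → punchIn j (punchIn k l))))

  expand₁⁺ : ∀ n (B : Fin (suc (suc n)) → Carrier) → ColumnFunctional n → Carrier
  expand₁⁺ n B G = Σ (suc n) (λ k → (sign (toℕ k) * B (suc k)) * G (λ l → suc (punchIn k l)))

  expand₂⁺-term : ∀ n (B : Fin (suc (suc n)) → Carrier) → ColumnFunctional n → Fin (suc n) → Fin n → Carrier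
  expand₂⁺-term n B G j k =
    (sign (toℕ (suc k)) * B (punchIn (suc j) (suc k))) * G (λ l → punchIn (suc j) (punchIn (suc k) l))

  expand₂⁺ : ∀ n (A B : Fin (suc (suc n)) → Carrier) → ColumnFunctional n → Carrier
  expand₂⁺ n A B G = Σ (suc n) (λ j → (sign (toℕ (suc j)) * A (suc j)) * Σ n (expand₂⁺-term n B G j))

  expand₂-split : ∀ n A B G →
    expand₂ n A B G ≈ A zero * expand₁⁺ n B G + (- (B zero * expand₁⁺ n A G) + expand₂⁺ n A B G)
  expand₂-split n A B G = begin
    expand₂ n A B G
      ≡⟨ Σ-suc (suc n) _ ⟩
    (sign 0 * A zero) * expand₁⁺ n B G + Σ (suc n) outer
      ≈⟨ +-cong (*-congʳ (trans (*-congʳ (reflexive sign-zero)) (*-identityˡ _))) (Σ-cong (suc n) splitOuter) ⟩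
    A zero * expand₁⁺ n B G + Σ (suc n) (λ j → - (B zero * a′ j) + (sign (toℕ (suc j)) * A (suc j)) * Σ n (expand₂⁺-term n B G j))
      ≈⟨ +-congˡ (Σ-distrib-+ (suc n) _ _) ⟩
    A zero * expand₁⁺ n B G + (Σ (suc n) (λ j → - (B zero * a′ j)) + expand₂⁺ n A B G)
      ≈⟨ +-congˡ (+-congʳ (sym (trans (-‿cong (*-distribˡ-Σ (suc n) (B zero) _)) (-‿distrib-Σ (suc n) _)))) ⟩
    A zero * expand₁⁺ n B G + (- (B zero * expand₁⁺ n A G) + expand₂⁺ n A B G) ∎
    where
    a′ : Fin (suc n) → Carrier
    a′ j = (sign (toℕ j) * A (suc j)) * G (λ l → suc (punchIn j l))
    outer : Fin (suc n) → Carrier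
    outer j = (sign (toℕ (suc j)) * A (suc j)) *
      Σ (suc n) (λ k → (sign (toℕ k) * B (punchIn (suc j) k)) * G (λ l → punchIn (suc j) (punchIn k l)))
    splitOuter : ∀ j → outer j ≈ - (B zero * a′ j) + (sign (toℕ (suc j)) * A (suc j)) * Σ n (expand₂⁺-term n B G j)
    splitOuter j = begin
      outer j
        ≡⟨ P.cong ((sign (toℕ (suc j)) * A (suc j)) *_) (Σ-suc n _) ⟩
      (sign (toℕ (suc j)) * A (suc j)) * ((sign 0 * B zero) * g + R)
        ≡⟨ P.cong₂ (λ σ σ₀ → (σ * A (suc j)) * ((σ₀ * B zero) * g + R)) (sign-suc (toℕ j)) sign-zero ⟩
      (- sign (toℕ j) * A (suc j)) * ((1# * B zero) * g + R)
        ≈⟨ *-congˡ (+-congʳ (*-congʳ (*-identityˡ _))) ⟩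
      (- sign (toℕ j) * A (suc j)) * (B zero * g + R)
        ≈⟨ solve 5 (λ s a b g r → (:- s :* a) :* (b :* g :+ r) := :- (b :* ((s :* a) :* g)) :+ (:- s :* a) :* r) refl
             (sign (toℕ j)) (A (suc j)) (B zero) g R ⟩
      - (B zero * a′ j) + (- sign (toℕ j) * A (suc j)) * R
        ≡⟨ P.cong (λ σ → - (B zero * a′ j) + (σ * A (suc j)) * R) (P.sym (sign-suc (toℕ j))) ⟩
      - (B zero * a′ j) + (sign (toℕ (suc j)) * A (suc j)) * R ∎
      where
      g = G (λ l → suc (punchIn j l))
      R = Σ n (expand₂⁺-term n B G j)

  expand₂⁺-empty : ∀ A B G → expand₂⁺ 0 A B G ≈ 0#
  expand₂⁺-empty A B G = Σ-vanishing 1 _ (λ j → trans (*-congˡ (reflexive (Σ-zero _))) (zeroʳ _))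

  expand₂⁺≈expand₂ : ∀ m A B G → Extensional G →
    expand₂⁺ (suc m) A B G ≈ expand₂ m (λ i → A (suc i)) (λ i → B (suc i)) (λ σ → G (Fin.lift 1 σ))
  expand₂⁺≈expand₂ m A B G G-ext = Σ-cong (suc (suc m)) (λ j → begin
    (sign (toℕ (suc j)) * A (suc j)) * Σ (suc m) (expand₂⁺-term (suc m) B G j)
      ≈⟨ *-congˡ (Σ-cong (suc m) (λ k → begin
           expand₂⁺-term (suc m) B G j k
             ≡⟨ P.cong (λ σ → (σ * B (suc (punchIn j k))) * G (λ l → punchIn (suc j) (punchIn (suc k) l))) (sign-suc (toℕ k)) ⟩
           (- sign (toℕ k) * B (suc (punchIn j k))) * G (λ l → punchIn (suc j) (punchIn (suc k) l))
             ≈⟨ *-congˡ (G-ext (λ { zero → P.refl ; (suc l) → P.refl })) ⟩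
           (- sign (toℕ k) * B (suc (punchIn j k))) * G′ j k
             ≈⟨ solve 3 (λ s b g → (:- s :* b) :* g := :- ((s :* b) :* g)) refl _ _ _ ⟩
           - ((sign (toℕ k) * B (suc (punchIn j k))) * G′ j k) ∎)) ⟩
    (sign (toℕ (suc j)) * A (suc j)) * Σ (suc m) (λ k → - ((sign (toℕ k) * B (suc (punchIn j k))) * G′ j k))
      ≈⟨ *-cong (*-congʳ (reflexive (sign-suc (toℕ j)))) (sym (-‿distrib-Σ (suc m) _)) ⟩
    (- sign (toℕ j) * A (suc j)) * - Σ (suc m) (λ k → (sign (toℕ k) * B (suc (punchIn j k))) * G′ j k)
      ≈⟨ solve 3 (λ s a x → (:- s :* a) :* (:- x) := (s :* a) :* x) refl _ _ _ ⟩
    (sign (toℕ j) * A (suc j)) * Σ (suc m) (λ k → (sign (toℕ k) * B (suc (punchIn j k))) * G′ j k) ∎)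
    where
    G′ : Fin (suc (suc m)) → Fin (suc m) → Carrier
    G′ j k = G (Fin.lift 1 (λ l → punchIn j (punchIn k l)))

  expand₂-antisym : ∀ n A B G → Extensional G → expand₂ n A B G ≈ - expand₂ n B A G
  expand₂⁺-antisym : ∀ n A B G → Extensional G → expand₂⁺ n A B G ≈ - expand₂⁺ n B A G

  expand₂-antisym n A B G G-ext = begin
    expand₂ n A B G
      ≈⟨ expand₂-split n A B G ⟩
    A zero * expand₁⁺ n B G + (- (B zero * expand₁⁺ n A G) + expand₂⁺ n A B G)
      ≈⟨ +-congˡ (+-congˡ (expand₂⁺-antisym n A B G G-ext)) ⟩
    A zero * expand₁⁺ n B G + (- (B zero * expand₁⁺ n A G) + - expand₂⁺ n B A G)
      ≈⟨ solve 3 (λ a b r → a :+ (:- b :+ :- r) := :- (b :+ (:- a :+ r))) refl _ _ _ ⟩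
    - (B zero * expand₁⁺ n A G + (- (A zero * expand₁⁺ n B G) + expand₂⁺ n B A G))
      ≈⟨ -‿cong (sym (expand₂-split n B A G)) ⟩
    - expand₂ n B A G ∎

  expand₂⁺-antisym zero    A B G G-ext =
    trans (expand₂⁺-empty A B G) (sym (trans (-‿cong (expand₂⁺-empty B A G)) -0#≈0#))
  expand₂⁺-antisym (suc m) A B G G-ext = begin
    expand₂⁺ (suc m) A B G                   ≈⟨ expand₂⁺≈expand₂ m A B G G-ext ⟩
    expand₂ m (λ i → A (suc i)) (λ i → B (suc i)) G′
      ≈⟨ expand₂-antisym m (λ i → A (suc i)) (λ i → B (suc i)) G′ G′-ext ⟩
    - expand₂ m (λ i → B (suc i)) (λ i → A (suc i)) G′
      ≈⟨ -‿cong (sym (expand₂⁺≈expand₂ m B A G G-ext)) ⟩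
    - expand₂⁺ (suc m) B A G                 ∎
    where
    G′ : ColumnFunctional m
    G′ σ = G (Fin.lift 1 σ)
    G′-ext : Extensional G′
    G′-ext σ≗τ = G-ext (λ { zero → P.refl ; (suc l) → P.cong suc (σ≗τ l) })

  lowerDet : ∀ n → Mat (suc (suc n)) → ColumnFunctional n
  lowerDet n M σ = Det n (λ i l → M (suc (suc i)) (σ l))

  det≈expand₂ : ∀ n M → Det (suc (suc n)) M ≈ expand₂ n (M zero) (M (suc zero)) (lowerDet n M)
  det≈expand₂ n M = trans (reflexive (Det-suc (suc n) M)) (Σ-cong (suc (suc n)) (λ j →
    reflexive (P.cong ((sign (toℕ j) * M zero j) *_) (Det-suc n (minor M j)))))

  transposeAt : ∀ {m} → Fin m → Fin (suc m) → Fin (suc m)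
  transposeAt zero    zero          = suc zero
  transposeAt zero    (suc zero)    = zero
  transposeAt zero    (suc (suc i)) = suc (suc i)
  transposeAt (suc k) zero          = zero
  transposeAt (suc k) (suc i)       = suc (transposeAt k i)

  transposeAt-inject₁ : ∀ {m} (k : Fin m) → transposeAt k (inject₁ k) ≡ suc k
  transposeAt-inject₁ zero    = P.refl
  transposeAt-inject₁ (suc k) = P.cong suc (transposeAt-inject₁ k)

  det-transposeRows : ∀ m (k : Fin m) (M : Mat (suc m)) → Det (suc m) (λ i → M (transposeAt k i)) ≈ - Det (suc m) M
  det-transposeRows (suc n) zero M = begin
    Det (suc (suc n)) (λ i → M (transposeAt zero i))
      ≈⟨ det≈expand₂ n _ ⟩
    expand₂ n (M (suc zero)) (M zero) (lowerDet n M)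
      ≈⟨ expand₂-antisym n _ _ _ (λ σ≗τ → det-cong n (λ i l → reflexive (P.cong (M (suc (suc i))) (σ≗τ l)))) ⟩
    - expand₂ n (M zero) (M (suc zero)) (lowerDet n M)
      ≈⟨ -‿cong (sym (det≈expand₂ n M)) ⟩
    - Det (suc (suc n)) M ∎
  det-transposeRows (suc m) (suc k) M = begin
    Det (suc (suc m)) M′                                           ≡⟨ Det-suc (suc m) M′ ⟩
    Σ (suc (suc m)) (laplaceTerm M′)                               ≈⟨ Σ-cong (suc (suc m)) (λ j →
                                                                       *-congˡ (det-transposeRows m k (minor M j))) ⟩
    Σ (suc (suc m)) (λ j → (sign (toℕ j) * M zero j) * - Det (suc m) (minor M j))
                                                                   ≈⟨ Σ-cong (suc (suc m)) (λ j → sym (-‿distribʳ-* _ _)) ⟩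
    Σ (suc (suc m)) (λ j → - laplaceTerm M j)                      ≈⟨ sym (-‿distrib-Σ (suc (suc m)) (laplaceTerm M)) ⟩
    - Σ (suc (suc m)) (laplaceTerm M)                              ≡⟨ P.cong -_ (P.sym (Det-suc (suc m) M)) ⟩
    - Det (suc (suc m)) M                                          ∎
    where
    M′ : Mat (suc (suc m))
    M′ i = M (transposeAt (suc k) i)

  det-repeatedRow : ∀ m (b : Fin m) (M : Mat (suc m)) → (∀ l → M zero l ≈ M (suc b) l) → Det (suc m) M ≈ 0#
  det-repeatedRow m b = moveUp (toℕ b) m b P.refl
    where
    -- Adjacent transpositions move the repeated row next to the first one;
    -- the extra argument r = toℕ b makes the recursion structural.
    moveUp : ∀ r m (b : Fin m) → toℕ b ≡ r → (M : Mat (suc m)) → (∀ l → M zero l ≈ M (suc b) l) → Det (suc m) M ≈ 0#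
    moveUp r (suc n) zero _ M M₀≈M₁ = x≈-x⇒x≈0 _ (begin
      Det (suc (suc n)) M                          ≈⟨ det-cong (suc (suc n)) swapped ⟩
      Det (suc (suc n)) (λ i → M (transposeAt zero i)) ≈⟨ det-transposeRows (suc n) zero M ⟩
      - Det (suc (suc n)) M                        ∎)
      where
      swapped : ∀ i l → M i l ≈ M (transposeAt zero i) l
      swapped zero          l = M₀≈M₁ l
      swapped (suc zero)    l = sym (M₀≈M₁ l)
      swapped (suc (suc i)) l = refl
    moveUp (suc r) (suc m) (suc b) b≡r M M₀≈Mb = begin
      Det (suc (suc m)) M     ≈⟨ sym (-‿involutive _) ⟩
      - - Det (suc (suc m)) M ≈⟨ -‿cong (sym (det-transposeRows (suc m) (suc b) M)) ⟩
      - Det (suc (suc m)) M′  ≈⟨ -‿cong (moveUp r (suc m) (inject₁ b)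
                                   (P.trans (FinP.toℕ-inject₁ b) (ℕP.suc-injective b≡r)) M′ M′₀≈M′b) ⟩
      - 0#                    ≈⟨ -0#≈0# ⟩
      0#                      ∎
      where
      M′ : Mat (suc (suc m))
      M′ i = M (transposeAt (suc b) i)
      M′₀≈M′b : ∀ l → M′ zero l ≈ M′ (suc (inject₁ b)) l
      M′₀≈M′b l = trans (M₀≈Mb l) (reflexive (P.cong (λ i → M (suc i) l) (P.sym (transposeAt-inject₁ b))))

  det-addMultipleOfRow₀ : ∀ m (b : Fin m) (M C : Mat (suc m)) k →
    (∀ i → ¬ (i ≡ suc b) → ∀ l → C i l ≈ M i l) →
    (∀ l → C (suc b) l ≈ M (suc b) l + k * M zero l) →
    Det (suc m) C ≈ Det (suc m) M
  det-addMultipleOfRow₀ m b M C k C≈M C_b≈ = begin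
    Det (suc m) C                      ≈⟨ det-linearInRow (suc m) (suc b) M R C k
                                            (λ i i≢b l → sym (C≈M i i≢b l))
                                            (λ i i≢b l → trans (R-other i i≢b l) (sym (C≈M i i≢b l)))
                                            (λ l → trans (C_b≈ l) (+-congˡ (*-congˡ (sym (R-row l))))) ⟩
    Det (suc m) M + k * Det (suc m) R  ≈⟨ +-congˡ (*-congˡ (det-repeatedRow m b R
                                            (λ l → trans (R-other zero (λ ()) l) (sym (R-row l))))) ⟩
    Det (suc m) M + k * 0#             ≈⟨ trans (+-congˡ (zeroʳ _)) (+-identityʳ _) ⟩
    Det (suc m) M                      ∎
    where
    R : Mat (suc m)
    R i l with i FinP.≟ suc b
    ... | yes _ = M zero l
    ... | no  _ = M i l
    R-other : ∀ i → ¬ (i ≡ suc b) → ∀ l → R i l ≈ M i l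
    R-other i i≢b l with i FinP.≟ suc b
    ... | yes i≡b = ⊥-elim (i≢b i≡b)
    ... | no  _   = refl
    R-row : ∀ l → R (suc b) l ≈ M zero l
    R-row l with suc b FinP.≟ suc b
    ... | yes _   = refl
    ... | no  b≢b = ⊥-elim (b≢b P.refl)

  -- Performs the row operations of det-addMultiplesOfRow₀ one at a time: in
  -- eliminatedBelow k only the rows 1 + i with i < k have been modified.
  module Elimination (m : ℕ) (M : Mat (suc m)) (d : Fin m → Carrier) where
    coefficientBelow : ℕ → Fin m → Carrier
    coefficientBelow k i with toℕ i ℕ.<? k
    ... | yes _ = d i
    ... | no  _ = 0#

    coefficientBelow-< : ∀ k i → toℕ i ℕ.< k → coefficientBelow k i ≡ d i
    coefficientBelow-< k i i<k with toℕ i ℕ.<? k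
    ... | yes _   = P.refl
    ... | no  i≮k = ⊥-elim (i≮k i<k)

    coefficientBelow-≮ : ∀ k i → ¬ (toℕ i ℕ.< k) → coefficientBelow k i ≡ 0#
    coefficientBelow-≮ k i i≮k with toℕ i ℕ.<? k
    ... | yes i<k = ⊥-elim (i≮k i<k)
    ... | no  _   = P.refl

    coefficientBelow-suc : ∀ k i → ¬ (toℕ i ≡ k) → coefficientBelow (suc k) i ≡ coefficientBelow k i
    coefficientBelow-suc k i i≢k with toℕ i ℕ.<? k
    ... | yes i<k = coefficientBelow-< (suc k) i (ℕP.m<n⇒m<1+n i<k)
    ... | no  i≮k = coefficientBelow-≮ (suc k) i (λ i<1+k → i≢k (ℕP.≤-antisym (ℕP.≤-pred i<1+k) (ℕP.≮⇒≥ i≮k)))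

    eliminatedBelow : ℕ → Mat (suc m)
    eliminatedBelow k zero    l = M zero l
    eliminatedBelow k (suc i) l = M (suc i) l + coefficientBelow k i * M zero l

    det-eliminatedBelow : ∀ k → Det (suc m) (eliminatedBelow k) ≈ Det (suc m) M
    det-eliminatedBelow zero = det-cong (suc m) unchanged
      where
      unchanged : ∀ i l → eliminatedBelow zero i l ≈ M i l
      unchanged zero    l = refl
      unchanged (suc i) l =
        trans (+-congˡ (trans (*-congʳ (reflexive (coefficientBelow-≮ 0 i (λ ())))) (zeroˡ _))) (+-identityʳ _)
    det-eliminatedBelow (suc k) with k ℕ.<? m
    ... | yes k<m = trans (det-addMultipleOfRow₀ m b (eliminatedBelow k) (eliminatedBelow (suc k)) (d b) others row-b)
                          (det-eliminatedBelow k)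
      where
      b : Fin m
      b = Fin.fromℕ< k<m
      b≡k : toℕ b ≡ k
      b≡k = FinP.toℕ-fromℕ< k<m
      others : ∀ i → ¬ (i ≡ suc b) → ∀ l → eliminatedBelow (suc k) i l ≈ eliminatedBelow k i l
      others zero    _   l = refl
      others (suc i) i≢b l = +-congˡ (*-congʳ (reflexive (coefficientBelow-suc k i
        (λ i≡k → i≢b (P.cong suc (FinP.toℕ-injective (P.trans i≡k (P.sym b≡k))))))))
      row-b : ∀ l → eliminatedBelow (suc k) (suc b) l ≈ eliminatedBelow k (suc b) l + d b * M zero l
      row-b l = begin
        M (suc b) l + coefficientBelow (suc k) b * M zero l
          ≈⟨ +-congˡ (*-congʳ (reflexive (coefficientBelow-< (suc k) b (ℕP.≤-reflexive (P.cong suc b≡k))))) ⟩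
        M (suc b) l + d b * M zero l
          ≈⟨ +-congʳ (sym (trans (+-congˡ (trans (*-congʳ (reflexive (coefficientBelow-≮ k b
                (λ b<k → ℕP.<-irrefl b≡k b<k)))) (zeroˡ _))) (+-identityʳ _))) ⟩
        (M (suc b) l + coefficientBelow k b * M zero l) + d b * M zero l ∎
    ... | no k≮m = trans (det-cong (suc m) unchanged) (det-eliminatedBelow k)
      where
      unchanged : ∀ i l → eliminatedBelow (suc k) i l ≈ eliminatedBelow k i l
      unchanged zero    l = refl
      unchanged (suc i) l = +-congˡ (*-congʳ (reflexive (coefficientBelow-suc k i
        (λ i≡k → k≮m (P.subst (ℕ._< m) i≡k (FinP.toℕ<n i))))))

  det-addMultiplesOfRow₀ : ∀ m (M N : Mat (suc m)) (d : Fin m → Carrier) →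
    (∀ l → N zero l ≈ M zero l) → (∀ i l → N (suc i) l ≈ M (suc i) l + d i * M zero l) →
    Det (suc m) N ≈ Det (suc m) M
  det-addMultiplesOfRow₀ m M N d N₀≈ N≈ = trans (det-cong (suc m) N≈eliminated) (det-eliminatedBelow m)
    where
    open Elimination m M d
    N≈eliminated : ∀ i l → N i l ≈ eliminatedBelow m i l
    N≈eliminated zero    l = N₀≈ l
    N≈eliminated (suc i) l =
      trans (N≈ i l) (+-congˡ (*-congʳ (reflexive (P.sym (coefficientBelow-< m i (FinP.toℕ<n i))))))

  det-zeroFirstColumn : ∀ m (A : Mat (suc m)) → (∀ i → A i zero ≈ 0#) → Det (suc m) A ≈ 0#
  det-zeroFirstColumn m A A₀≈0 = trans (reflexive (Det-suc m A)) (Σ-vanishing (suc m) (laplaceTerm A) (vanishing m A A₀≈0))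
    where
    vanishing : ∀ m (A : Mat (suc m)) → (∀ i → A i zero ≈ 0#) → ∀ j → laplaceTerm A j ≈ 0#
    vanishing m       A A₀≈0 zero    = trans (*-congʳ (trans (*-congˡ (A₀≈0 zero)) (zeroʳ _))) (zeroˡ _)
    vanishing (suc m) A A₀≈0 (suc j) = trans (*-congˡ (det-zeroFirstColumn m (minor A (suc j)) (λ i → A₀≈0 (suc i)))) (zeroʳ _)

  det-pivot : ∀ m (N : Mat (suc m)) → (∀ i → N (suc i) zero ≈ 0#) →
    Det (suc m) N ≈ N zero zero * Det m (λ i l → N (suc i) (suc l))
  det-pivot m N N₀≈0 = begin
    Det (suc m) N
      ≡⟨ P.trans (Det-suc m N) (Σ-suc m (laplaceTerm N)) ⟩
    (sign 0 * N zero zero) * Det m (minor N zero) + Σ m (λ j → laplaceTerm N (suc j))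
      ≈⟨ +-cong (*-congʳ (trans (*-congʳ (reflexive sign-zero)) (*-identityˡ _))) (Σ-vanishing m _ (vanishing m N N₀≈0)) ⟩
    N zero zero * Det m (λ i l → N (suc i) (suc l)) + 0#
      ≈⟨ +-identityʳ _ ⟩
    N zero zero * Det m (λ i l → N (suc i) (suc l)) ∎
    where
    vanishing : ∀ m (N : Mat (suc m)) → (∀ i → N (suc i) zero ≈ 0#) → ∀ j → laplaceTerm N (suc j) ≈ 0#
    vanishing (suc m) N N₀≈0 j = trans (*-congˡ (det-zeroFirstColumn m (minor N (suc j)) N₀≈0)) (zeroʳ _)

  -- Cauchy determinants

  cauchyMatrix : ∀ n → (ℕ → Carrier) → (ℕ → Carrier) → Mat n
  cauchyMatrix n x y i l = (x (suc (toℕ l)) - y (suc (toℕ i))) ⁻¹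

  Separated : (ℕ → Carrier) → (ℕ → Carrier) → Set ℓ
  Separated x y = ∀ i l → Nonzero (x (suc l) - y (suc i))

  -- The factors of ∏_{i,l ≤ n} (x_l − y_i) and of ∏_{a < j ≤ n} (x_j − x_a)(y_a − y_j)
  -- whose largest index is j.
  cauchyDenominatorAt cauchyNumeratorAt : ℕ → (ℕ → Carrier) → (ℕ → Carrier) → Carrier
  cauchyDenominatorAt j x y = ∏ j (λ k → x j - y k) * ∏ (j ∸ 1) (λ k → x k - y j)
  cauchyNumeratorAt   j x y = ∏ (j ∸ 1) (λ a → x j - x a) * ∏ (j ∸ 1) (λ a → y a - y j)

  cauchyDenominator cauchyNumerator : ℕ → (ℕ → Carrier) → (ℕ → Carrier) → Carrier
  cauchyDenominator zero    x y = 1#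
  cauchyDenominator (suc n) x y = cauchyDenominator n x y * cauchyDenominatorAt (suc n) x y
  cauchyNumerator   zero    x y = 1#
  cauchyNumerator   (suc n) x y = cauchyNumerator n x y * cauchyNumeratorAt (suc n) x y

  cauchyDenominatorFirst cauchyNumeratorFirst : ℕ → (ℕ → Carrier) → (ℕ → Carrier) → Carrier
  cauchyDenominatorFirst n x y = (x 1 - y 1) * (∏ n (λ k → x 1 - y (suc k)) * ∏ n (λ k → x (suc k) - y 1))
  cauchyNumeratorFirst   n x y = ∏ n (λ k → y (suc k) - y 1) * ∏ n (λ k → x 1 - x (suc k))

  ∏-one : ∀ f → ∏ 1 f ≈ f 1
  ∏-one f = trans (reflexive (P.trans (∏-suc 0 f) (P.cong (_* f 1) (∏-zero f)))) (*-identityˡ _)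

  cauchyDenominator-peelFirst : ∀ n x y →
    cauchyDenominator (suc n) x y ≈ cauchyDenominatorFirst n x y * cauchyDenominator n (λ k → x (suc k)) (λ k → y (suc k))
  cauchyDenominator-peelFirst zero    x y = begin
    1# * (∏ 1 (λ k → x 1 - y k) * ∏ 0 (λ k → x k - y 1))
      ≈⟨ *-congˡ (*-cong (∏-one _) (reflexive (∏-zero _))) ⟩
    1# * ((x 1 - y 1) * 1#)
      ≈⟨ solve 1 (λ d → con (+ 1) :* (d :* con (+ 1)) := (d :* (con (+ 1) :* con (+ 1))) :* con (+ 1)) refl _ ⟩
    ((x 1 - y 1) * (1# * 1#)) * 1#
      ≡⟨ P.cong (λ z → ((x 1 - y 1) * z) * 1#) (P.sym (P.cong₂ _*_ (∏-zero _) (∏-zero _))) ⟩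
    cauchyDenominatorFirst 0 x y * 1# ∎
  cauchyDenominator-peelFirst (suc n) x y = begin
    cauchyDenominator (suc n) x y * cauchyDenominatorAt (suc (suc n)) x y
      ≈⟨ *-cong (cauchyDenominator-peelFirst n x y) (*-cong (∏-peelˡ (suc n) _) (∏-peelˡ n _)) ⟩
    (cauchyDenominatorFirst n x y * D′) * ((p * Q) * (q * R))
      ≈⟨ solve 8 (λ d A B D p Q q R → ((d :* (A :* B)) :* D) :* ((p :* Q) :* (q :* R))
            := (d :* ((A :* q) :* (B :* p))) :* (D :* (Q :* R))) refl
           (x 1 - y 1) (∏ n (λ k → x 1 - y (suc k))) (∏ n (λ k → x (suc k) - y 1)) D′ p Q q R ⟩
    ((x 1 - y 1) * ((∏ n (λ k → x 1 - y (suc k)) * q) * (∏ n (λ k → x (suc k) - y 1) * p))) * (D′ * (Q * R))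
      ≡⟨ P.cong₂ (λ u v → ((x 1 - y 1) * (u * v)) * (D′ * (Q * R))) (P.sym (∏-suc n _)) (P.sym (∏-suc n _)) ⟩
    cauchyDenominatorFirst (suc n) x y * cauchyDenominator (suc n) x′ y′ ∎
    where
    x′ y′ : ℕ → Carrier
    x′ k = x (suc k)
    y′ k = y (suc k)
    D′ = cauchyDenominator n x′ y′
    p = x (suc (suc n)) - y 1
    q = x 1 - y (suc (suc n))
    Q = ∏ (suc n) (λ k → x (suc (suc n)) - y (suc k))
    R = ∏ n (λ k → x (suc k) - y (suc (suc n)))

  cauchyNumerator-peelFirst : ∀ n x y →
    cauchyNumerator (suc n) x y ≈ cauchyNumeratorFirst n x y * cauchyNumerator n (λ k → x (suc k)) (λ k → y (suc k))
  cauchyNumerator-peelFirst zero    x y = begin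
    1# * (∏ 0 (λ a → x 1 - x a) * ∏ 0 (λ a → y a - y 1)) ≡⟨ P.cong (1# *_) (P.cong₂ _*_ (∏-zero _) (∏-zero _)) ⟩
    1# * (1# * 1#)                                        ≈⟨ *-comm _ _ ⟩
    (1# * 1#) * 1#                                        ≡⟨ P.cong (_* 1#) (P.sym (P.cong₂ _*_ (∏-zero _) (∏-zero _))) ⟩
    cauchyNumeratorFirst 0 x y * 1#                       ∎
  cauchyNumerator-peelFirst (suc n) x y = begin
    cauchyNumerator (suc n) x y * cauchyNumeratorAt (suc (suc n)) x y
      ≈⟨ *-cong (cauchyNumerator-peelFirst n x y) (*-cong (∏-peelˡ n _) (∏-peelˡ n _)) ⟩
    (cauchyNumeratorFirst n x y * N′) * (((xₙ - x 1) * Q) * ((y 1 - yₙ) * R))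
      ≈⟨ solve 9 (λ Y X N xₙ x₁ y₁ yₙ Q R → ((Y :* X) :* N) :* (((xₙ :- x₁) :* Q) :* ((y₁ :- yₙ) :* R))
            := ((Y :* (yₙ :- y₁)) :* (X :* (x₁ :- xₙ))) :* (N :* (Q :* R))) refl
           (∏ n (λ k → y (suc k) - y 1)) (∏ n (λ k → x 1 - x (suc k))) N′ xₙ (x 1) (y 1) yₙ Q R ⟩
    ((∏ n (λ k → y (suc k) - y 1) * (yₙ - y 1)) * (∏ n (λ k → x 1 - x (suc k)) * (x 1 - xₙ))) * (N′ * (Q * R))
      ≡⟨ P.cong₂ (λ u v → (u * v) * (N′ * (Q * R))) (P.sym (∏-suc n _)) (P.sym (∏-suc n _)) ⟩
    cauchyNumeratorFirst (suc n) x y * cauchyNumerator (suc n) x′ y′ ∎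
    where
    x′ y′ : ℕ → Carrier
    x′ k = x (suc k)
    y′ k = y (suc k)
    N′ = cauchyNumerator n x′ y′
    xₙ = x (suc (suc n))
    yₙ = y (suc (suc n))
    Q = ∏ n (λ a → x (suc (suc n)) - x (suc a))
    R = ∏ n (λ a → y (suc a) - y (suc (suc n)))

  schurEntry : ∀ x₁ y₁ X Y → Nonzero (X - Y) → Nonzero (x₁ - Y) → Nonzero (X - y₁) →
    (X - Y) ⁻¹ + (- ((x₁ - Y) ⁻¹ * (x₁ - y₁))) * (X - y₁) ⁻¹ ≈
    ((Y - y₁) * (x₁ - Y) ⁻¹) * (((x₁ - X) * (X - y₁) ⁻¹) * (X - Y) ⁻¹)
  schurEntry x₁ y₁ X Y u≉0 v≉0 w≉0 = begin
    u⁻¹ + (- (v⁻¹ * (x₁ - y₁))) * w⁻¹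
      ≈⟨ +-cong (sym (trans (*-congˡ (*-cong (⁻¹-inverse _ v≉0) (⁻¹-inverse _ w≉0)))
                       (trans (*-congˡ (*-identityʳ _)) (*-identityʳ _))))
                (sym (trans (*-congˡ (⁻¹-inverse _ u≉0)) (*-identityʳ _))) ⟩
    u⁻¹ * (((x₁ - Y) * v⁻¹) * ((X - y₁) * w⁻¹)) + ((- (v⁻¹ * (x₁ - y₁))) * w⁻¹) * ((X - Y) * u⁻¹)
      ≈⟨ solve 7 (λ x₁ y₁ X Y u v w →
            u :* (((x₁ :- Y) :* v) :* ((X :- y₁) :* w)) :+ ((:- (v :* (x₁ :- y₁))) :* w) :* ((X :- Y) :* u)
            := ((Y :- y₁) :* v) :* (((x₁ :- X) :* w) :* u)) refl x₁ y₁ X Y u⁻¹ v⁻¹ w⁻¹ ⟩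
    ((Y - y₁) * v⁻¹) * (((x₁ - X) * w⁻¹) * u⁻¹) ∎
    where
    u⁻¹ = (X - Y) ⁻¹
    v⁻¹ = (x₁ - Y) ⁻¹
    w⁻¹ = (X - y₁) ⁻¹

  det-cauchy : ∀ n x y → Separated x y → Det n (cauchyMatrix n x y) * cauchyDenominator n x y ≈ cauchyNumerator n x y
  det-cauchy zero    x y sep = trans (*-congʳ (reflexive (Det-zero _))) (*-identityˡ _)
  det-cauchy (suc m) x y sep = begin
    Det (suc m) C * cauchyDenominator (suc m) x y
      ≈⟨ *-cong eliminate (cauchyDenominator-peelFirst m x y) ⟩
    (d₀ ⁻¹ * (Π m a * (Π m b * Det m C′))) * ((d₀ * (colDen * rowDen)) * D′)
      ≈⟨ *-congʳ (*-congˡ (*-cong (trans (Π≈∏ m rowScale) (∏-distrib-* m _ _)) (*-congʳ (trans (Π≈∏ m columnScale) (∏-distrib-* m _ _))))) ⟩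
    (d₀ ⁻¹ * ((yGaps * colDen⁻¹) * ((xGaps * rowDen⁻¹) * Det m C′))) * ((d₀ * (colDen * rowDen)) * D′)
      ≈⟨ solve 10 (λ d₀⁻¹ d₀ yGaps colDen⁻¹ colDen xGaps rowDen⁻¹ rowDen detC′ D′ →
           (d₀⁻¹ :* ((yGaps :* colDen⁻¹) :* ((xGaps :* rowDen⁻¹) :* detC′))) :* ((d₀ :* (colDen :* rowDen)) :* D′)
           := ((d₀⁻¹ :* d₀) :* ((colDen⁻¹ :* colDen) :* (rowDen⁻¹ :* rowDen))) :* ((yGaps :* xGaps) :* (detC′ :* D′))) refl
           (d₀ ⁻¹) d₀ yGaps colDen⁻¹ colDen xGaps rowDen⁻¹ rowDen (Det m C′) D′ ⟩
    ((d₀ ⁻¹ * d₀) * ((colDen⁻¹ * colDen) * (rowDen⁻¹ * rowDen))) * ((yGaps * xGaps) * (Det m C′ * D′))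
      ≈⟨ *-cong (trans (*-cong (⁻¹-inverseˡ d₀ (sep 0 0))
                               (*-cong (∏-inverse m (λ k → x 1 - y (suc k)) (λ k → sep (suc k) 0))
                                       (∏-inverse m (λ k → x (suc k) - y 1) (λ k → sep 0 (suc k)))))
                       (trans (*-identityˡ _) (*-identityʳ _)))
                (*-congˡ (det-cauchy m x′ y′ (λ i l → sep (suc i) (suc l)))) ⟩
    1# * ((yGaps * xGaps) * cauchyNumerator m x′ y′)
      ≈⟨ *-identityˡ _ ⟩
    cauchyNumeratorFirst m x y * cauchyNumerator m x′ y′
      ≈⟨ sym (cauchyNumerator-peelFirst m x y) ⟩
    cauchyNumerator (suc m) x y ∎
    where
    C = cauchyMatrix (suc m) x y
    x′ y′ : ℕ → Carrier
    x′ k = x (suc k)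
    y′ k = y (suc k)
    C′ = cauchyMatrix m x′ y′
    d₀ = x 1 - y 1
    d : Fin m → Carrier
    d i = - (C (suc i) zero * d₀)
    N : Mat (suc m)
    N zero    l = C zero l
    N (suc i) l = C (suc i) l + d i * C zero l
    N-firstColumn : ∀ i → N (suc i) zero ≈ 0#
    N-firstColumn i = begin
      v + (- (v * d₀)) * d₀ ⁻¹  ≈⟨ +-congˡ (trans (sym (-‿distribˡ-* _ _))
                                     (-‿cong (trans (*-assoc _ _ _) (trans (*-congˡ (⁻¹-inverse d₀ (sep 0 0))) (*-identityʳ _))))) ⟩
      v - v                     ≈⟨ -‿inverseʳ v ⟩
      0#                        ∎
      where v = C (suc i) zero
    rowScale columnScale : ℕ → Carrier
    rowScale k = (y (suc k) - y 1) * (x 1 - y (suc k)) ⁻¹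
    columnScale k = (x 1 - x (suc k)) * (x (suc k) - y 1) ⁻¹
    a b : Fin m → Carrier
    a i = rowScale (suc (toℕ i))
    b l = columnScale (suc (toℕ l))
    schurComplement : ∀ i l → N (suc i) (suc l) ≈ a i * (b l * C′ i l)
    schurComplement i l = schurEntry (x 1) (y 1) (x (suc (suc (toℕ l)))) (y (suc (suc (toℕ i))))
      (sep (suc (toℕ i)) (suc (toℕ l))) (sep (suc (toℕ i)) 0) (sep 0 (suc (toℕ l)))
    eliminate : Det (suc m) C ≈ d₀ ⁻¹ * (Π m a * (Π m b * Det m C′))
    eliminate = begin
      Det (suc m) C                                      ≈⟨ sym (det-addMultiplesOfRow₀ m C N d (λ l → refl) (λ i l → refl)) ⟩
      Det (suc m) N                                      ≈⟨ det-pivot m N N-firstColumn ⟩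
      d₀ ⁻¹ * Det m (λ i l → N (suc i) (suc l))          ≈⟨ *-congˡ (det-cong m schurComplement) ⟩
      d₀ ⁻¹ * Det m (λ i l → a i * (b l * C′ i l))       ≈⟨ *-congˡ (det-scaleRows m a _) ⟩
      d₀ ⁻¹ * (Π m a * Det m (λ i l → b l * C′ i l))     ≈⟨ *-congˡ (*-congˡ (det-scaleColumns m b C′)) ⟩
      d₀ ⁻¹ * (Π m a * (Π m b * Det m C′))               ∎
    yGaps colDen⁻¹ colDen xGaps rowDen⁻¹ rowDen D′ : Carrier
    yGaps = ∏ m (λ k → y (suc k) - y 1)
    colDen⁻¹ = ∏ m (λ k → (x 1 - y (suc k)) ⁻¹)
    colDen = ∏ m (λ k → x 1 - y (suc k))
    xGaps = ∏ m (λ k → x 1 - x (suc k))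
    rowDen⁻¹ = ∏ m (λ k → (x (suc k) - y 1) ⁻¹)
    rowDen = ∏ m (λ k → x (suc k) - y 1)
    D′ = cauchyDenominator m x′ y′

  -- The nodes of D_s

  module Nodes (t : Carrier) where
    x y : ℕ → Carrier
    x k = pow F (ι (2 *ℕ k)) 2
    y k = pow F t 2 * pow F (ι (2 *ℕ k ∸ 1)) 2

    D≈det-cauchyMatrix : ∀ s → D F t s ≈ Det s (cauchyMatrix s x y)
    D≈det-cauchyMatrix s = trans (reflexive (P.sym (Det≡det s _))) (det-cong s (λ i l → *-identityˡ _))

    square-cong : ∀ {a b} → a ≈ b → pow F a 2 ≈ pow F b 2
    square-cong a≈b = *-cong a≈b (*-congʳ a≈b)

    ι-2k∸1 : ∀ k → 1 ≤ k → ι (2 *ℕ k ∸ 1) ≈ ι 2 * ι k - 1#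
    ι-2k∸1 (suc k) _ = trans (ι-homo-∸ (2 *ℕ suc k) 1 (s≤s z≤n)) (+-cong (ι-homo-* 2 (suc k)) (-‿cong (+-identityʳ 1#)))

    weight : ℕ → ℕ → ℕ
    weight n a = ((suc n ∸ a) *ℕ (suc n ∸ a)) *ℕ ((suc n +ℕ a) *ℕ (n +ℕ a))

    cauchyNumerator-factor : ∀ n a → 1 ≤ a → a ≤ n →
      (x (suc n) - x a) * (y a - y (suc n)) ≈ (- ι 16 * pow F t 2) * ι (weight n a)
    cauchyNumerator-factor n a 1≤a a≤n = begin
      (x (suc n) - x a) * (y a - y (suc n))
        ≈⟨ *-cong (+-cong (square-cong (ι-homo-* 2 (suc n))) (-‿cong (square-cong (ι-homo-* 2 a))))
                  (+-cong (*-congˡ (square-cong (ι-2k∸1 a 1≤a))) (-‿cong (*-congˡ (square-cong (ι-2k∸1 (suc n) (s≤s z≤n)))))) ⟩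
      (sq (ι 2 * (1# + N)) - sq (ι 2 * A)) * (sq t * sq (ι 2 * A - 1#) - sq t * sq (ι 2 * (1# + N) - 1#))
        ≈⟨ solve 3 (λ N A t →
             (sq′ (con (+ 2) :* (con (+ 1) :+ N)) :- sq′ (con (+ 2) :* A)) :*
             (sq′ t :* sq′ (con (+ 2) :* A :- con (+ 1)) :- sq′ t :* sq′ (con (+ 2) :* (con (+ 1) :+ N) :- con (+ 1)))
             := (:- con (+ 16) :* sq′ t) :* ((((con (+ 1) :+ N) :- A) :* ((con (+ 1) :+ N) :- A)) :* ((con (+ 1) :+ (N :+ A)) :* (N :+ A))))
             refl N A t ⟩
      (- ι 16 * sq t) * ((((1# + N) - A) * ((1# + N) - A)) * ((1# + (N + A)) * (N + A)))
        ≈⟨ *-congˡ (sym ι-weight) ⟩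
      (- ι 16 * pow F t 2) * ι (weight n a) ∎
      where
      N = ι n
      A = ι a
      sq : Carrier → Carrier
      sq z = pow F z 2
      sq′ : ∀ {k} → Polynomial k → Polynomial k
      sq′ p = p :* (p :* con (+ 1))
      ι-1+n∸a : ι (suc n ∸ a) ≈ (1# + N) - A
      ι-1+n∸a = ι-homo-∸ (suc n) a (ℕP.m≤n⇒m≤1+n a≤n)
      ι-weight : ι (weight n a) ≈ (((1# + N) - A) * ((1# + N) - A)) * ((1# + (N + A)) * (N + A))
      ι-weight = begin
        ι (weight n a)
          ≈⟨ ι-homo-* ((suc n ∸ a) *ℕ (suc n ∸ a)) ((suc n +ℕ a) *ℕ (n +ℕ a)) ⟩
        ι ((suc n ∸ a) *ℕ (suc n ∸ a)) * ι ((suc n +ℕ a) *ℕ (n +ℕ a))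
          ≈⟨ *-cong (trans (ι-homo-* (suc n ∸ a) (suc n ∸ a)) (*-cong ι-1+n∸a ι-1+n∸a))
                    (trans (ι-homo-* (suc n +ℕ a) (n +ℕ a)) (*-cong (+-congˡ (ι-homo-+ n a)) (ι-homo-+ n a))) ⟩
        (((1# + N) - A) * ((1# + N) - A)) * ((1# + (N + A)) * (N + A)) ∎

    cauchyNumeratorAt-closedForm : ∀ n →
      cauchyNumeratorAt (suc n) x y ≈ ((sign n * pow F (ι 16) n) * pow F (pow F t 2) n) * ι (∏ℕ n (weight n))
    cauchyNumeratorAt-closedForm n = begin
      ∏ n (λ a → x (suc n) - x a) * ∏ n (λ a → y a - y (suc n))
        ≈⟨ sym (∏-distrib-* n _ _) ⟩
      ∏ n (λ a → (x (suc n) - x a) * (y a - y (suc n)))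
        ≈⟨ ∏-cong n (λ i i<n → cauchyNumerator-factor n (suc i) (s≤s z≤n) i<n) ⟩
      ∏ n (λ a → (- ι 16 * pow F t 2) * ι (weight n a))
        ≈⟨ ∏-distrib-* n _ _ ⟩
      ∏ n (λ _ → - ι 16 * pow F t 2) * ∏ n (λ a → ι (weight n a))
        ≈⟨ *-cong (∏-const n _) (sym (ι-∏ℕ n (weight n))) ⟩
      pow F (- ι 16 * pow F t 2) n * ι (∏ℕ n (weight n))
        ≈⟨ *-congʳ (trans (pow-distrib-* n _ _) (*-congʳ (pow-neg n _))) ⟩
      ((sign n * pow F (ι 16) n) * pow F (pow F t 2) n) * ι (∏ℕ n (weight n)) ∎

    pow-n+n : ∀ n → pow F t (n +ℕ n) ≈ pow F (pow F t 2) n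
    pow-n+n zero    = refl
    pow-n+n (suc n) = begin
      t * pow F t (n +ℕ suc n)       ≡⟨ P.cong (λ e → t * pow F t e) (ℕP.+-suc n n) ⟩
      t * (t * pow F t (n +ℕ n))     ≈⟨ *-congˡ (*-congˡ (pow-n+n n)) ⟩
      t * (t * pow F (pow F t 2) n)  ≈⟨ solve 2 (λ t p → t :* (t :* p) := (t :* (t :* con (+ 1))) :* p) refl _ _ ⟩
      pow F (pow F t 2) (suc n)      ∎

    Udenominator : ℕ → Carrier
    Udenominator n =
      prod1 F (suc n) (λ k → pow F (ι (2 *ℕ k ∸ 1)) 2 * pow F t 2 - pow F (ι (2 *ℕ suc n)) 2)
      * prod1 F n (λ k → pow F (ι (2 *ℕ suc n ∸ 1)) 2 * pow F t 2 - pow F (ι (2 *ℕ k)) 2)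

    Udenominator≈-cauchyDenominatorAt : ∀ n → Udenominator n ≈ - cauchyDenominatorAt (suc n) x y
    Udenominator≈-cauchyDenominatorAt n = begin
      Udenominator n
        ≡⟨ P.sym (P.cong₂ _*_ (∏≡prod1 (suc n) _) (∏≡prod1 n _)) ⟩
      ∏ (suc n) _ * ∏ n _
        ≈⟨ *-cong (∏-cong (suc n) (λ k _ → flip _ _ _)) (∏-cong n (λ k _ → flip _ _ _)) ⟩
      ∏ (suc n) (λ k → - (x (suc n) - y k)) * ∏ n (λ k → - (x k - y (suc n)))
        ≈⟨ *-cong (∏-neg (suc n) _) (∏-neg n _) ⟩
      (sign (suc n) * ∏ (suc n) (λ k → x (suc n) - y k)) * (sign n * ∏ n (λ k → x k - y (suc n)))
        ≡⟨ P.cong (λ σ → (σ * ∏ (suc n) (λ k → x (suc n) - y k)) * (sign n * ∏ n (λ k → x k - y (suc n)))) (sign-suc n) ⟩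
      (- sign n * ∏ (suc n) (λ k → x (suc n) - y k)) * (sign n * ∏ n (λ k → x k - y (suc n)))
        ≈⟨ solve 3 (λ s a b → (:- s :* a) :* (s :* b) := :- ((s :* s) :* (a :* b))) refl _ _ _ ⟩
      - ((sign n * sign n) * cauchyDenominatorAt (suc n) x y)
        ≈⟨ -‿cong (trans (*-congʳ (sign-square n)) (*-identityˡ _)) ⟩
      - cauchyDenominatorAt (suc n) x y ∎
      where
      flip : ∀ a b c → a * b - c ≈ - (c - b * a)
      flip a b c = solve 3 (λ a b c → a :* b :- c := :- (c :- b :* a)) refl a b c

    U-unfold : ∀ n → U F t (suc n) ≈
      ((((pow F t (n +ℕ n) * - sign n) * pow F (ι 16) n) * ι ((n +ℕ n) !)) * Udenominator n ⁻¹)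
        * (ι (suc (n +ℕ n) !) * ι (suc n) ⁻¹)
    U-unfold n = reflexive (P.trans
      (P.cong₂ (λ e o → shape e o (sgn F (suc n))) (2*[1+n]∸2≡n+n n) (2*[1+n]∸1≡1+n+n n))
      (P.cong (λ σ → shape (n +ℕ n) (suc (n +ℕ n)) (- σ)) (P.sym (sign≡sgn n))))
      where
      shape : ℕ → ℕ → Carrier → Carrier
      shape e o σ = ((((pow F t e * σ) * pow F (ι 16) n) * ι (e !)) * Udenominator n ⁻¹) * (ι (o !) * ι (suc n) ⁻¹)

    U*cauchyDenominatorAt : ∀ n → Nonzero (cauchyDenominatorAt (suc n) x y) →
      U F t (suc n) * cauchyDenominatorAt (suc n) x y ≈ cauchyNumeratorAt (suc n) x y
    U*cauchyDenominatorAt n den≉0 = begin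
      U F t (suc n) * den
        ≈⟨ *-congʳ (U-unfold n) ⟩
      (((((tⁿⁿ * (- σ)) * p16) * fa) * Q⁻¹) * (fb * J⁻¹)) * den
        ≈⟨ solve 8 (λ tⁿⁿ σ p16 fa Q⁻¹ fb J⁻¹ den → (((((tⁿⁿ :* (:- σ)) :* p16) :* fa) :* Q⁻¹) :* (fb :* J⁻¹)) :* den
              := (((tⁿⁿ :* σ) :* p16) :* (:- (Q⁻¹ :* den))) :* ((fa :* fb) :* J⁻¹)) refl tⁿⁿ σ p16 fa Q⁻¹ fb J⁻¹ den ⟩
      (((tⁿⁿ * σ) * p16) * (- (Q⁻¹ * den))) * ((fa * fb) * J⁻¹)
        ≈⟨ *-cong (*-congˡ (-‿cong Q⁻¹*den≈-1)) (*-congʳ factorials) ⟩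
      (((tⁿⁿ * σ) * p16) * (- (- 1#))) * ((J * W) * J⁻¹)
        ≈⟨ solve 6 (λ tⁿⁿ σ p16 J W J⁻¹ → (((tⁿⁿ :* σ) :* p16) :* (:- (:- con (+ 1)))) :* ((J :* W) :* J⁻¹)
              := (((σ :* p16) :* tⁿⁿ) :* W) :* (J :* J⁻¹)) refl tⁿⁿ σ p16 J W J⁻¹ ⟩
      (((σ * p16) * tⁿⁿ) * W) * (J * J⁻¹)
        ≈⟨ trans (*-congˡ (⁻¹-inverse J (charZero n))) (*-identityʳ _) ⟩
      ((σ * p16) * tⁿⁿ) * W
        ≈⟨ *-congʳ (*-congˡ (pow-n+n n)) ⟩
      ((σ * p16) * pow F (pow F t 2) n) * W
        ≈⟨ sym (cauchyNumeratorAt-closedForm n) ⟩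
      cauchyNumeratorAt (suc n) x y ∎
      where
      den = cauchyDenominatorAt (suc n) x y
      tⁿⁿ = pow F t (n +ℕ n)
      σ = sign n
      p16 = pow F (ι 16) n
      fa = ι ((n +ℕ n) !)
      fb = ι (suc (n +ℕ n) !)
      Q⁻¹ = Udenominator n ⁻¹
      J = ι (suc n)
      J⁻¹ = J ⁻¹
      W = ι (∏ℕ n (weight n))
      factorials : fa * fb ≈ J * W
      factorials = begin
        fa * fb                      ≈⟨ sym (ι-homo-* ((n +ℕ n) !) (suc (n +ℕ n) !)) ⟩
        ι ((n +ℕ n) ! *ℕ suc (n +ℕ n) !) ≡⟨ P.cong ι (factorials-as-∏ n) ⟩
        ι (suc n *ℕ ∏ℕ n (weight n)) ≈⟨ ι-homo-* (suc n) (∏ℕ n (weight n)) ⟩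
        J * W                        ∎
      Q≈-den : Udenominator n ≈ - den
      Q≈-den = Udenominator≈-cauchyDenominatorAt n
      Q⁻¹*den≈-1 : Q⁻¹ * den ≈ - 1#
      Q⁻¹*den≈-1 = begin
        Q⁻¹ * den                     ≈⟨ *-congˡ (sym (-‿involutive den)) ⟩
        Q⁻¹ * - - den                 ≈⟨ sym (-‿distribʳ-* _ _) ⟩
        - (Q⁻¹ * - den)               ≈⟨ -‿cong (*-congˡ (sym Q≈-den)) ⟩
        - (Q⁻¹ * Udenominator n)      ≈⟨ -‿cong (⁻¹-inverseˡ _ (λ Q≈0 → den≉0 (trans (sym (-‿involutive den))
                                           (trans (-‿cong (trans (sym Q≈-den) Q≈0)) -0#≈0#)))) ⟩
        - 1#                          ∎

    module WithoutPoles (noPoles : (m k : ℕ) → 1 ≤ m → 1 ≤ k →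
                         ¬ (ι (2 *ℕ m ∸ 1) * t ≈ ι (2 *ℕ k)) × ¬ (ι (2 *ℕ m ∸ 1) * t ≈ - ι (2 *ℕ k))) where
      separated : Separated x y
      separated i l = *-nonzero diff≉0 sum≉0 ∘ trans (sym difference-of-squares)
        where
        a = ι (2 *ℕ suc l)
        b = ι (2 *ℕ suc i ∸ 1)
        difference-of-squares : x (suc l) - y (suc i) ≈ (a - b * t) * (a + b * t)
        difference-of-squares = solve 3 (λ a b t → a :* (a :* con (+ 1)) :- (t :* (t :* con (+ 1))) :* (b :* (b :* con (+ 1)))
                                                   := (a :- b :* t) :* (a :+ b :* t)) refl a b t
        diff≉0 : Nonzero (a - b * t)
        diff≉0 = proj₁ (noPoles (suc i) (suc l) (s≤s z≤n) (s≤s z≤n)) ∘ sym ∘ x∙y⁻¹≈ε⇒x≈y a (b * t)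
        sum≉0 : Nonzero (a + b * t)
        sum≉0 = proj₂ (noPoles (suc i) (suc l) (s≤s z≤n) (s≤s z≤n)) ∘ +-inverseʳ-unique a (b * t)

      cauchyDenominatorAt-nonzero : ∀ n → Nonzero (cauchyDenominatorAt (suc n) x y)
      cauchyDenominatorAt-nonzero n = *-nonzero (∏-nonzero (suc n) (λ k → x (suc n) - y k) (λ k → separated k n))
                                                (∏-nonzero n (λ k → x k - y (suc n)) (λ k → separated n k))

      cauchyDenominator-nonzero : ∀ s → Nonzero (cauchyDenominator s x y)
      cauchyDenominator-nonzero zero    = 1≉0
      cauchyDenominator-nonzero (suc s) = *-nonzero (cauchyDenominator-nonzero s) (cauchyDenominatorAt-nonzero s)

      ∏U*cauchyDenominator : ∀ s → ∏ s (U F t) * cauchyDenominator s x y ≈ cauchyNumerator s x y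
      ∏U*cauchyDenominator zero    = trans (*-congʳ (reflexive (∏-zero _))) (*-identityˡ _)
      ∏U*cauchyDenominator (suc s) = begin
        ∏ (suc s) (U F t) * (cauchyDenominator s x y * cauchyDenominatorAt (suc s) x y)
          ≡⟨ P.cong (_* (cauchyDenominator s x y * cauchyDenominatorAt (suc s) x y)) (∏-suc s _) ⟩
        (∏ s (U F t) * U F t (suc s)) * (cauchyDenominator s x y * cauchyDenominatorAt (suc s) x y)
          ≈⟨ interchange _ _ _ _ ⟩
        (∏ s (U F t) * cauchyDenominator s x y) * (U F t (suc s) * cauchyDenominatorAt (suc s) x y)
          ≈⟨ *-cong (∏U*cauchyDenominator s) (U*cauchyDenominatorAt s (cauchyDenominatorAt-nonzero s)) ⟩
        cauchyNumerator s x y * cauchyNumeratorAt (suc s) x y ∎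

mainTheorem2 : {c ℓ : Level} (F : CharZeroField c ℓ) (t : CharZeroField.Carrier F) →
    ((m k : ℕ) → 1 ≤ m → 1 ≤ k →
      ¬ (CharZeroField._≈_ F (CharZeroField._*_ F (CharZeroField.ι F (2 *ℕ m ∸ 1)) t) (CharZeroField.ι F (2 *ℕ k)))
      × ¬ (CharZeroField._≈_ F (CharZeroField._*_ F (CharZeroField.ι F (2 *ℕ m ∸ 1)) t) (CharZeroField.-_ F (CharZeroField.ι F (2 *ℕ k))))) →
    (s : ℕ) → 1 ≤ s →
    CharZeroField._≈_ F (D F t s) (prod1 F s (U F t))
mainTheorem2 F t noPoles s _ = begin
  D F t s                     ≈⟨ D≈det-cauchyMatrix s ⟩
  Det s (cauchyMatrix s x y)  ≈⟨ *-cancelʳ (cauchyDenominator s x y) (cauchyDenominator-nonzero s)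
                                   (trans (det-cauchy s x y separated) (sym (∏U*cauchyDenominator s))) ⟩
  ∏ s (U F t)                 ≡⟨ ∏≡prod1 s (U F t) ⟩
  prod1 F s (U F t)           ∎
  where
  open CharZeroField F using (setoid; sym; trans)
  open import Relation.Binary.Reasoning.Setoid setoid
  open CharZero F
  open Nodes t
  open WithoutPoles noPoles
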